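{- Consider walks with steps in $\{(1,0),(-1,0),(0,1),(0,-1)\}$ on the slit plane. For every $n\ge 0$, the number of such walks of length $2n+1$ ending at $(1,0)$ is the Catalan number $C_{2n+1}$. More precisely, for $0\le m\le n$, the number of such walks having exactly $2m$ vertical steps is $4^m\binom{2n}{2m}C_{n-m}$. This is also the number of bicolored Motzkin walks of length $2n$ with $2m$ horizontal steps.
   Context: A walk is a finite sequence $(w_0,\dots,w_n)$ of points of $\mathbb Z^2$ with $w_0=(0,0)$ and each $w_k-w_{k-1}$ a step; $n$ is its length. It is a walk on the slit plane if none of $w_1,\dots,w_n$ lies on the half-line $\mathcal H=\{(k,0):k\le 0\}$. Vertical steps are $(0,\pm1)$, horizontal steps are $(\pm1,0)$. A bicolored Motzkin walk is a walk with these four steps that ends on the $x$-axis and never visits a point of negative ordinate. $C_n=\frac{1}{n+1}\binom{2n}{n}$. -}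

module Defs where

open import Data.Nat using (ℕ; zero; suc; _+_; _*_; _/_)
open import Data.Nat.Combinatorics using (_C_)
open import Data.Integer as ℤ using (ℤ; +_; -[1+_]; 0ℤ; 1ℤ)
open import Data.Bool using (Bool; true; false; _∧_; not; if_then_else_)
open import Data.List using (List; []; _∷_; length; filter; concatMap; map)
open import Data.Product using (_×_; _,_)
open import Relation.Nullary.Decidable using (⌊_⌋)
open import Relation.Binary.PropositionalEquality using (_≡_)

data Step : Set where
  E W N S : Step

allSteps : List Step
allSteps = E ∷ W ∷ N ∷ S ∷ []

Point : Set
Point = ℤ × ℤ

move : Point → Step → Point
move (x , y) E = (x ℤ.+ 1ℤ , y)
move (x , y) W = (x ℤ.- 1ℤ , y)
move (x , y) N = (x , y ℤ.+ 1ℤ)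
move (x , y) S = (x , y ℤ.- 1ℤ)

origin : Point
origin = (0ℤ , 0ℤ)

-- A walk of length n is its list of n steps, starting at the origin.
-- All step sequences of length n (each appears exactly once):
walks : ℕ → List (List Step)
walks zero = [] ∷ []
walks (suc n) = concatMap (λ w → map (λ s → s ∷ w) allSteps) (walks n)

endFrom : Point → List Step → Point
endFrom p [] = p
endFrom p (s ∷ w) = endFrom (move p s) w

endpoint : List Step → Point
endpoint = endFrom origin

onH : Point → Bool
onH (x , y) = ⌊ y ℤ.≟ 0ℤ ⌋ ∧ ⌊ x ℤ.≤? 0ℤ ⌋

-- none of w_1..w_n (points after each step, starting from p) lies on H
avoidsHFrom : Point → List Step → Bool
avoidsHFrom p [] = true
avoidsHFrom p (s ∷ w) = not (onH (move p s)) ∧ avoidsHFrom (move p s) w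

onSlitPlane : List Step → Bool
onSlitPlane = avoidsHFrom origin

nonNegFrom : Point → List Step → Bool
nonNegFrom (x , y) [] = ⌊ 0ℤ ℤ.≤? y ⌋
nonNegFrom (x , y) (s ∷ w) = ⌊ 0ℤ ℤ.≤? y ⌋ ∧ nonNegFrom (move (x , y) s) w

isBicoloredMotzkin : List Step → Bool
isBicoloredMotzkin w with endpoint w
... | (_ , y) = ⌊ y ℤ.≟ 0ℤ ⌋ ∧ nonNegFrom origin w

isVertical : Step → Bool
isVertical N = true
isVertical S = true
isVertical _ = false

isHorizontal : Step → Bool
isHorizontal s = not (isVertical s)

countSteps : (Step → Bool) → List Step → ℕ
countSteps p [] = 0
countSteps p (s ∷ w) = (if p s then 1 else 0) + countSteps p w

endsAt : Point → List Step → Bool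
endsAt (a , b) w with endpoint w
... | (x , y) = ⌊ x ℤ.≟ a ⌋ ∧ ⌊ y ℤ.≟ b ⌋

numWalks : ℕ → (List Step → Bool) → ℕ
numWalks n P = length (filter (λ w → P w Data.Bool.≟ true) (walks n))

catalan : ℕ → ℕ
catalan n = ((2 * n) C n) / suc n

point10 : Point
point10 = (1ℤ , 0ℤ)

{-# OPTIONS --safe #-}

-- Cut a slit-plane walk w from (0,0) to (1,0) after its last leftmost point e = (c, d), w = P R, and
-- send it to σR P, where σ exchanges N and S. Since R runs in x > c and P in x ≥ c, the walk σR P,
-- started at the origin, stays in the half-plane x ≥ 1 and ends at (1, 2d). Its points on the line
-- y = d come from points of w on the x-axis, which lie right of the slit, so the cut is recovered as
-- the last leftmost point of σR P on that line, and an odd walk ending on x = 1 always meets the line.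
-- This bijection keeps the number of vertical steps. A half-plane walk of length 2n + 1 starts with E
-- and is then a bicoloured Motzkin path of length 2n read along the x-axis (E, W up and down, N, S the
-- two level steps). Those with j level steps number C(2n, j) 2^j D(2n - j), where D counts Dyck paths,
-- and all of them number D(4n + 2), reading Dyck paths two steps at a time; finally D(2k) = C_k by the
-- ballot formula.
module Submission where

open import Defs
open import Data.Bool as Bool using (Bool; true; false; T; not; _∧_)
open import Data.Bool.Properties using (T-≡; T-∧)
open import Data.Empty using (⊥; ⊥-elim)
open import Data.List using (List; []; _∷_; _++_; length; map; filter; concatMap)
open import Data.List.Membership.Propositional using (_∈_)
open import Data.List.Relation.Unary.All as All using (All; []; _∷_)
open import Data.List.Relation.Unary.Any using (here; there)
open import Data.List.Relation.Unary.Unique.Propositional using (Unique; []; _∷_)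
open import Data.Maybe using (Maybe; just; nothing; maybe′)
open import Data.Product using (_×_; _,_; proj₁; proj₂; ∃; ∃-syntax)
open import Function using (_∘_; id; _⇔_; mk⇔; Equivalence)
open import Relation.Nullary using (¬_; yes; no)
open import Relation.Nullary.Decidable using (⌊_⌋; toWitness; fromWitness)
open import Relation.Binary.PropositionalEquality
open import Relation.Binary.Definitions using (tri<; tri≈; tri>)

module Enumeration where

  open import Data.Nat using (ℕ; zero; suc; _+_; _≤_; z≤n; s≤s)
  open import Data.Nat.Properties using (≤-antisym)
  open import Data.Nat.Tactic.RingSolver using (solve-∀)
  open import Data.List.Properties using (length-++; length-map; filter-++)
  open import Data.List.Membership.Propositional.Properties
    using (∈-map⁺; ∈-map⁻; ∈-++⁺ˡ; ∈-++⁺ʳ; ∈-++⁻; ∈-∃++; ∈-filter⁺; ∈-filter⁻;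
           ∈-concat⁺′; ∈-concat⁻′)
  import Data.List.Relation.Unary.AllPairs.Properties as AllPairs
  import Data.List.Relation.Unary.Unique.Propositional.Properties as Unique
  open import Data.List.Relation.Binary.Subset.Propositional using (_⊆_)
  open import Data.Sum using (inj₁; inj₂)

  length-mono-⊆ : {A : Set} {xs ys : List A} → Unique xs → xs ⊆ ys → length xs ≤ length ys
  length-mono-⊆ {xs = []} [] _ = z≤n
  length-mono-⊆ {xs = x ∷ xs} (x∉xs ∷ xs!) x∷xs⊆ys with ∈-∃++ (x∷xs⊆ys (here refl))
  ... | as , bs , refl = subst (_ ≤_) (sym (length-++-∷ as)) (s≤s (length-mono-⊆ xs! xs⊆as++bs))
    where
    length-++-∷ : ∀ as → length (as ++ x ∷ bs) ≡ suc (length (as ++ bs))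
    length-++-∷ [] = refl
    length-++-∷ (_ ∷ as) = cong suc (length-++-∷ as)
    xs⊆as++bs : xs ⊆ as ++ bs
    xs⊆as++bs {z} z∈xs with ∈-++⁻ as (x∷xs⊆ys (there z∈xs))
    ... | inj₁ z∈as = ∈-++⁺ˡ z∈as
    ... | inj₂ (here refl) = ⊥-elim (All.lookup x∉xs z∈xs refl)
    ... | inj₂ (there z∈bs) = ∈-++⁺ʳ as z∈bs

  unique-map⁺ : {A B : Set} {f : A → B} {xs : List A} →
                (∀ {x y} → x ∈ xs → y ∈ xs → f x ≡ f y → x ≡ y) → Unique xs → Unique (map f xs)
  unique-map⁺ inj [] = []
  unique-map⁺ {f = f} inj (x∉xs ∷ xs!) =
    All.tabulate fx∉ ∷ unique-map⁺ (λ x∈ y∈ → inj (there x∈) (there y∈)) xs!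
    where
    fx∉ : ∀ {z} → z ∈ map f _ → f _ ≢ z
    fx∉ z∈ fx≡z with ∈-map⁻ f z∈
    ... | y , y∈xs , refl = All.lookup x∉xs y∈xs (inj (here refl) (there y∈xs) fx≡z)

  count : (List Step → Bool) → List (List Step) → ℕ
  count P ws = length (filter (λ w → P w Bool.≟ true) ws)

  indicator : Bool → ℕ
  indicator true = 1
  indicator false = 0

  count-∷ : ∀ P w ws → count P (w ∷ ws) ≡ indicator (P w) + count P ws
  count-∷ P w ws with P w
  ... | true = refl
  ... | false = refl

  count-++ : ∀ P xs ys → count P (xs ++ ys) ≡ count P xs + count P ys
  count-++ P xs ys = trans (cong length (filter-++ _ xs ys)) (length-++ (filter _ xs))

  count-cong : ∀ {P Q} → (∀ w → P w ≡ Q w) → ∀ ws → count P ws ≡ count Q ws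
  count-cong P≗Q [] = refl
  count-cong {P} {Q} P≗Q (w ∷ ws) = begin
    count P (w ∷ ws)             ≡⟨ count-∷ P w ws ⟩
    indicator (P w) + count P ws ≡⟨ cong₂ _+_ (cong indicator (P≗Q w)) (count-cong P≗Q ws) ⟩
    indicator (Q w) + count Q ws ≡⟨ count-∷ Q w ws ⟨
    count Q (w ∷ ws)             ∎
    where open ≡-Reasoning

  extensions : List Step → List (List Step)
  extensions w = map (_∷ w) allSteps

  firstStepCounts : (List Step → Bool) → List (List Step) → ℕ
  firstStepCounts P ws =
    count (P ∘ (E ∷_)) ws + count (P ∘ (W ∷_)) ws + count (P ∘ (N ∷_)) ws + count (P ∘ (S ∷_)) ws

  count-by-first-step : ∀ P ws → count P (concatMap extensions ws) ≡ firstStepCounts P ws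
  count-by-first-step P [] = refl
  count-by-first-step P (w ∷ ws) = begin
    count P (extensions w ++ concatMap extensions ws)
      ≡⟨ count-++ P (extensions w) _ ⟩
    count P (extensions w) + count P (concatMap extensions ws)
      ≡⟨ cong₂ _+_ count-extensions (count-by-first-step P ws) ⟩
    (e + (w′ + (n + (s + 0)))) + (es + ws′ + ns + ss)
      ≡⟨ regroup e w′ n s es ws′ ns ss ⟩
    (e + es) + (w′ + ws′) + (n + ns) + (s + ss)
      ≡⟨ cong₂ _+_ (cong₂ _+_ (cong₂ _+_ (count-∷ (P ∘ (E ∷_)) w ws) (count-∷ (P ∘ (W ∷_)) w ws))
                               (count-∷ (P ∘ (N ∷_)) w ws)) (count-∷ (P ∘ (S ∷_)) w ws) ⟨
    firstStepCounts P (w ∷ ws)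
      ∎
    where
    open ≡-Reasoning
    e = indicator (P (E ∷ w)); w′ = indicator (P (W ∷ w))
    n = indicator (P (N ∷ w)); s = indicator (P (S ∷ w))
    es = count (P ∘ (E ∷_)) ws; ws′ = count (P ∘ (W ∷_)) ws
    ns = count (P ∘ (N ∷_)) ws; ss = count (P ∘ (S ∷_)) ws
    count-extensions : count P (extensions w) ≡ e + (w′ + (n + (s + 0)))
    count-extensions = trans (count-∷ P _ _) (cong (e +_) (trans (count-∷ P _ _)
      (cong (w′ +_) (trans (count-∷ P _ _) (cong (n +_) (count-∷ P _ _))))))
    regroup : ∀ a b c d p q r t →
              (a + (b + (c + (d + 0)))) + (p + q + r + t) ≡ (a + p) + (b + q) + (c + r) + (d + t)
    regroup = solve-∀

  ∈-walks : ∀ w → w ∈ walks (length w)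
  ∈-walks [] = here refl
  ∈-walks (s ∷ w) = ∈-concat⁺′ (∈-extensions s) (∈-map⁺ extensions (∈-walks w))
    where
    ∈-extensions : ∀ s → s ∷ w ∈ extensions w
    ∈-extensions E = here refl
    ∈-extensions W = there (here refl)
    ∈-extensions N = there (there (here refl))
    ∈-extensions S = there (there (there (here refl)))

  ∈-extensions⁻ : ∀ {v w} → v ∈ extensions w → ∃ λ s → v ≡ s ∷ w
  ∈-extensions⁻ (here refl) = E , refl
  ∈-extensions⁻ (there (here refl)) = W , refl
  ∈-extensions⁻ (there (there (here refl))) = N , refl
  ∈-extensions⁻ (there (there (there (here refl)))) = S , refl

  ∈-walks⁻ : ∀ {L v} → v ∈ walks (suc L) → ∃ λ s → ∃ λ w → v ≡ s ∷ w × w ∈ walks L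
  ∈-walks⁻ {L} v∈ with ∈-concat⁻′ (map extensions (walks L)) v∈
  ... | vs , v∈vs , vs∈ with ∈-map⁻ extensions vs∈
  ... | w , w∈ , refl with ∈-extensions⁻ v∈vs
  ... | s , v≡s∷w = s , w , v≡s∷w , w∈

  walks-length : ∀ L {w} → w ∈ walks L → length w ≡ L
  walks-length zero (here refl) = refl
  walks-length (suc L) w∈ with ∈-walks⁻ {L} w∈
  ... | _ , _ , refl , w∈′ = cong suc (walks-length L w∈′)

  walks-unique : ∀ L → Unique (walks L)
  walks-unique zero = [] ∷ []
  walks-unique (suc L) = extensions-unique (walks L) (walks-unique L)
    where
    extensions-unique : ∀ ws → Unique ws → Unique (concatMap extensions ws)
    extensions-unique [] [] = []
    extensions-unique (w ∷ ws) (w∉ws ∷ ws!) =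
      AllPairs.++⁺ fresh (extensions-unique ws ws!)
        (All.tabulate λ u∈ → All.tabulate λ v∈ → disjoint u∈ v∈)
      where
      fresh : Unique (extensions w)
      fresh = ((λ ()) ∷ (λ ()) ∷ (λ ()) ∷ []) ∷ ((λ ()) ∷ (λ ()) ∷ []) ∷ ((λ ()) ∷ []) ∷ [] ∷ []
      disjoint : ∀ {u v} → u ∈ extensions w → v ∈ concatMap extensions ws → u ≢ v
      disjoint u∈ v∈ u≡v with ∈-extensions⁻ u∈ | ∈-concat⁻′ (map extensions ws) v∈
      ... | _ , refl | vs , v∈vs , vs∈ with ∈-map⁻ extensions vs∈
      ... | w′ , w′∈ , refl with ∈-extensions⁻ v∈vs
      ... | _ , refl = All.lookup w∉ws w′∈ (cong tail u≡v)
        where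
        tail : List Step → List Step
        tail [] = []
        tail (_ ∷ w) = w

  InjectionOn : ℕ → (P Q : List Step → Bool) (f g : List Step → List Step) → Set
  InjectionOn L P Q f g = ∀ w → length w ≡ L → T (P w) → length (f w) ≡ L × T (Q (f w)) × g (f w) ≡ w

  numWalks-≤ : ∀ L P Q f g → InjectionOn L P Q f g → numWalks L P ≤ numWalks L Q
  numWalks-≤ L P Q f g inverse = subst (_≤ numWalks L Q) (length-map f Ps)
    (length-mono-⊆ (unique-map⁺ f-injective Ps-unique) image⊆Qs)
    where
    Ps = filter (λ w → P w Bool.≟ true) (walks L)
    Ps-unique : Unique Ps
    Ps-unique = Unique.filter⁺ _ (walks-unique L)
    ∈Ps⁻ : ∀ {w} → w ∈ Ps → length w ≡ L × T (P w)
    ∈Ps⁻ w∈ with ∈-filter⁻ (λ w → P w Bool.≟ true) {xs = walks L} w∈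
    ... | w∈walks , Pw = walks-length L w∈walks , Equivalence.from T-≡ Pw
    left-inverse : ∀ {w} → w ∈ Ps → g (f w) ≡ w
    left-inverse w∈ = let (ℓ , Pw) = ∈Ps⁻ w∈ in proj₂ (proj₂ (inverse _ ℓ Pw))
    f-injective : ∀ {u v} → u ∈ Ps → v ∈ Ps → f u ≡ f v → u ≡ v
    f-injective u∈ v∈ fu≡fv = trans (sym (left-inverse u∈)) (trans (cong g fu≡fv) (left-inverse v∈))
    image⊆Qs : map f Ps ⊆ filter (λ w → Q w Bool.≟ true) (walks L)
    image⊆Qs v∈ with ∈-map⁻ f v∈
    ... | w , w∈ , refl with ∈Ps⁻ w∈
    ... | ℓ , Pw with inverse w ℓ Pw
    ... | ℓ′ , Qfw , _ =
      ∈-filter⁺ _ (subst (λ k → f w ∈ walks k) ℓ′ (∈-walks (f w))) (Equivalence.to T-≡ Qfw)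

  numWalks-bijection : ∀ L P Q f g → InjectionOn L P Q f g → InjectionOn L Q P g f → numWalks L P ≡ numWalks L Q
  numWalks-bijection L P Q f g f-inverse g-inverse =
    ≤-antisym (numWalks-≤ L P Q f g f-inverse) (numWalks-≤ L Q P g f g-inverse)

  numWalks-suc : ∀ L P → numWalks (suc L) P ≡
    numWalks L (P ∘ (E ∷_)) + numWalks L (P ∘ (W ∷_)) + numWalks L (P ∘ (N ∷_)) + numWalks L (P ∘ (S ∷_))
  numWalks-suc L P = count-by-first-step P (walks L)

  numWalks-cong : ∀ L {P Q} → (∀ w → P w ≡ Q w) → numWalks L P ≡ numWalks L Q
  numWalks-cong L P≗Q = count-cong P≗Q (walks L)

  numWalks-none : ∀ L {P} → (∀ w → P w ≡ false) → numWalks L P ≡ 0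
  numWalks-none L P≗false = trans (numWalks-cong L P≗false) (count-none (walks L))
    where
    count-none : ∀ ws → count (λ _ → false) ws ≡ 0
    count-none [] = refl
    count-none (_ ∷ ws) = count-none ws

module LatticePathNumbers where

  open import Data.Nat using (ℕ; zero; suc; _+_; _*_; _∸_; _^_; _≤_; _<_; z≤n; s≤s; _≤?_)
  open import Data.Nat.Properties
  open import Data.Nat.Combinatorics
    using (_C_; nCk≡nC[n∸k]; nCk+nC[k+1]≡[n+1]C[k+1]; nC1≡n; k>n⇒nCk≡0)
  open import Data.Nat.DivMod using (_/_; m*n/n≡m)
  open import Data.Nat.Tactic.RingSolver using (solve-∀)
  open import Relation.Nullary using (yes; no)
  open ≡-Reasoning

  atPred : (ℕ → ℕ) → ℕ → ℕ
  atPred f zero = 0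
  atPred f (suc a) = f a

  atPred-cong : ∀ {f g} → (∀ b → f b ≡ g b) → ∀ a → atPred f a ≡ atPred g a
  atPred-cong f≗g zero = refl
  atPred-cong f≗g (suc a) = f≗g a

  atPred-scale : ∀ c f a → atPred (λ b → c * f b) a ≡ c * atPred f a
  atPred-scale c f zero = sym (*-zeroʳ c)
  atPred-scale c f (suc a) = refl

  -- dyck l a: paths of l steps ±1 from height a to height 0 that never go below 0.
  dyck : ℕ → ℕ → ℕ
  dyck zero zero = 1
  dyck zero (suc a) = 0
  dyck (suc l) zero = dyck l 1
  dyck (suc l) (suc a) = dyck l (suc (suc a)) + dyck l a

  dyck-suc : ∀ l a → dyck (suc l) a ≡ dyck l (suc a) + atPred (dyck l) a
  dyck-suc l zero = sym (+-identityʳ _)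
  dyck-suc l (suc a) = refl

  dyck-out-of-reach : ∀ l a → l < a → dyck l a ≡ 0
  dyck-out-of-reach zero (suc a) _ = refl
  dyck-out-of-reach (suc l) (suc (suc a)) (s≤s l<2+a) =
    cong₂ _+_ (dyck-out-of-reach l (3 + a) (m<n⇒m<1+n (m<n⇒m<1+n l<2+a)))
              (dyck-out-of-reach l (suc a) l<2+a)

  dyck-straight-down : ∀ a → dyck a a ≡ 1
  dyck-straight-down zero = refl
  dyck-straight-down (suc a) =
    trans (cong (_+ dyck a a) (dyck-out-of-reach a (2 + a) (m<n⇒m<1+n (n<1+n a)))) (dyck-straight-down a)

  pascal : ∀ n k → suc n C suc k ≡ n C k + n C suc k
  pascal n k = sym (nCk+nC[k+1]≡[n+1]C[k+1] n k)

  pascal-atPred : ∀ n k → suc n C k ≡ atPred (n C_) k + n C k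
  pascal-atPred n zero = refl
  pascal-atPred n (suc k) = pascal n k

  -- Reflection principle: the ±1 paths of length n from a to 0 are the n C u choices of u up-steps;
  -- reflecting after the first visit to -1 maps those going below 0 onto the n C (u - 1) paths to -2.
  dyck-ballot : ∀ u a n → n ≡ a + (u + u) → dyck n a + atPred (n C_) u ≡ n C u
  dyck-ballot zero a n refl =
    trans (+-identityʳ _) (trans (cong (λ n → dyck n a) (+-identityʳ a)) (dyck-straight-down a))
  dyck-ballot (suc u) zero (suc (suc m)) n≡ = begin
    dyck (suc m) 1 + suc (suc m) C u
      ≡⟨ cong (dyck (suc m) 1 +_) (pascal-atPred _ u) ⟩
    dyck (suc m) 1 + (atPred (suc m C_) u + suc m C u)
      ≡⟨ +-assoc (dyck (suc m) 1) _ _ ⟨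
    dyck (suc m) 1 + atPred (suc m C_) u + suc m C u
      ≡⟨ cong (_+ suc m C u) (dyck-ballot u 1 (suc m) (cong suc m≡u+u)) ⟩
    suc m C u + suc m C u
      ≡⟨ cong (suc m C u +_) middle ⟩
    suc m C u + suc m C suc u
      ≡⟨ pascal (suc m) u ⟨
    suc (suc m) C suc u
      ∎
    where
    m≡u+u : m ≡ u + u
    m≡u+u = suc-injective (trans (suc-injective n≡) (+-suc u u))
    middle : suc m C u ≡ suc m C suc u
    middle = sym (trans (nCk≡nC[n∸k] (s≤s (subst (u ≤_) (sym m≡u+u) (m≤m+n u u))))
                        (cong (suc m C_) (trans (cong (_∸ u) m≡u+u) (m+n∸n≡m u u))))
  dyck-ballot (suc u) zero (suc zero) n≡ with () ← trans (suc-injective n≡) (+-suc u u)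
  dyck-ballot (suc u) (suc a) (suc n) n≡ = begin
    dyck n (2 + a) + dyck n a + suc n C u
      ≡⟨ cong (dyck n (2 + a) + dyck n a +_) (pascal-atPred _ u) ⟩
    dyck n (2 + a) + dyck n a + (atPred (n C_) u + n C u)
      ≡⟨ regroup (dyck n (2 + a)) (dyck n a) (atPred (n C_) u) (n C u) ⟩
    (dyck n (2 + a) + atPred (n C_) u) + (dyck n a + atPred (n C_) (suc u))
      ≡⟨ cong₂ _+_ (dyck-ballot u (2 + a) n n≡′) (dyck-ballot (suc u) a n (suc-injective n≡)) ⟩
    n C u + n C suc u
      ≡⟨ pascal n u ⟨
    suc n C suc u
      ∎
    where
    n≡′ : n ≡ 2 + a + (u + u)
    n≡′ = trans (suc-injective n≡) (shift a u)
      where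
      shift : ∀ a u → a + (suc u + suc u) ≡ 2 + a + (u + u)
      shift = solve-∀
    regroup : ∀ p q r s → p + q + (r + s) ≡ (p + r) + (q + s)
    regroup = solve-∀

  absorption : ∀ n k → suc k * (suc n C suc k) ≡ suc n * (n C k)
  absorption zero zero = refl
  absorption zero (suc k) rewrite k>n⇒nCk≡0 {1} {2 + k} (s≤s (s≤s z≤n)) = *-zeroʳ (2 + k)
  absorption (suc n) zero = trans (+-identityʳ _) (trans (nC1≡n (2 + n)) (sym (*-identityʳ (2 + n))))
  absorption (suc n) (suc k) = begin
    (2 + k) * ((2 + n) C (2 + k))
      ≡⟨ cong ((2 + k) *_) (pascal (suc n) (suc k)) ⟩
    (2 + k) * (c + (suc n) C (2 + k))
      ≡⟨ split c ((suc n) C (2 + k)) k ⟩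
    c + suc k * c + (2 + k) * ((suc n) C (2 + k))
      ≡⟨ cong₂ (λ x y → c + x + y) (absorption n k) (absorption n (suc k)) ⟩
    c + suc n * (n C k) + suc n * (n C suc k)
      ≡⟨ merge c (n C k) (n C suc k) n ⟩
    c + suc n * (n C k + n C suc k)
      ≡⟨ cong (λ x → c + suc n * x) (pascal n k) ⟨
    (2 + n) * c
      ∎
    where
    c = suc n C suc k
    split : ∀ a b k → (2 + k) * (a + b) ≡ a + suc k * a + (2 + k) * b
    split = solve-∀
    merge : ∀ a p q n → a + suc n * p + suc n * q ≡ a + suc n * (p + q)
    merge = solve-∀

  central-absorption : ∀ k → k * ((k + k) C k) ≡ suc k * atPred ((k + k) C_) k
  central-absorption zero = refl
  central-absorption (suc j) =
    subst (λ n → suc j * (n C suc j) ≡ (2 + j) * (n C j)) (cong suc (sym (+-suc j j))) (sym (begin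
      (2 + j) * (n C j)
        ≡⟨ cong ((2 + j) *_) (trans (nCk≡nC[n∸k] j≤n) (cong (n C_) n∸j≡2+j)) ⟩
      (2 + j) * (n C (2 + j))
        ≡⟨ absorption (suc (j + j)) (suc j) ⟩
      n * (suc (j + j) C suc j)
        ≡⟨ cong (n *_) (trans (nCk≡nC[n∸k] (s≤s (m≤m+n j j))) (cong (suc (j + j) C_) (m+n∸m≡n j j))) ⟩
      n * (suc (j + j) C j)
        ≡⟨ absorption (suc (j + j)) j ⟨
      suc j * (n C suc j)
        ∎))
    where
    n = 2 + (j + j)
    j≤n : j ≤ n
    j≤n = ≤-trans (m≤m+n j j) (≤-trans (n≤1+n _) (n≤1+n _))
    n∸j≡2+j : n ∸ j ≡ 2 + j
    n∸j≡2+j = trans (cong (_∸ j) (sym (+-assoc 2 j j))) (m+n∸n≡m (2 + j) j)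

  dyck-central : ∀ k → dyck (k + k) 0 * suc k ≡ (k + k) C k
  dyck-central k = +-cancelʳ-≡ (suc k * X) _ _ (begin
    D * suc k + suc k * X     ≡⟨ distrib D X k ⟩
    suc k * (D + X)           ≡⟨ cong (suc k *_) (dyck-ballot k 0 (k + k) refl) ⟩
    n C k + k * (n C k)       ≡⟨ cong (n C k +_) (central-absorption k) ⟩
    n C k + suc k * X         ∎)
    where
    n = k + k
    D = dyck n 0
    X = atPred (n C_) k
    distrib : ∀ d x k → d * suc k + suc k * x ≡ suc k * (d + x)
    distrib = solve-∀

  catalan≡dyck : ∀ k → catalan k ≡ dyck (2 * k) 0
  catalan≡dyck k = begin
    ((2 * k) C k) / suc k              ≡⟨ cong (λ n → (n C k) / suc k) 2k≡k+k ⟩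
    ((k + k) C k) / suc k              ≡⟨ cong (_/ suc k) (dyck-central k) ⟨
    (dyck (k + k) 0 * suc k) / suc k   ≡⟨ m*n/n≡m (dyck (k + k) 0) (suc k) ⟩
    dyck (k + k) 0                     ≡⟨ cong (λ n → dyck n 0) 2k≡k+k ⟨
    dyck (2 * k) 0                     ∎
    where
    2k≡k+k : 2 * k ≡ k + k
    2k≡k+k = cong (k +_) (+-identityʳ k)

  -- motzkin L a j: bicoloured Motzkin paths of length L from height a to height 0 with j level steps.
  motzkin : ℕ → ℕ → ℕ → ℕ
  motzkin zero zero zero = 1
  motzkin zero zero (suc j) = 0
  motzkin zero (suc a) j = 0
  motzkin (suc L) a j =
    motzkin L (suc a) j + atPred (λ b → motzkin L b j) a + atPred (motzkin L a) j + atPred (motzkin L a) j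

  binomial-dyck-boundary : ∀ L j a x →
    (L C suc j) * x * dyck (suc (L ∸ suc j)) a ≡ (L C suc j) * x * dyck (L ∸ j) a
  binomial-dyck-boundary L j a x with suc j ≤? L
  ... | yes j<L = cong (λ l → (L C suc j) * x * dyck l a) (sym (+-∸-assoc 1 j<L))
  ... | no j≮L rewrite k>n⇒nCk≡0 (≰⇒> j≮L) = refl

  motzkin≡binomial*dyck : ∀ L a j → motzkin L a j ≡ (L C j) * 2 ^ j * dyck (L ∸ j) a
  motzkin≡binomial*dyck zero zero zero = refl
  motzkin≡binomial*dyck zero zero (suc j) = refl
  motzkin≡binomial*dyck zero (suc a) zero = refl
  motzkin≡binomial*dyck zero (suc a) (suc j) = refl
  motzkin≡binomial*dyck (suc L) a zero = begin
    motzkin L (suc a) 0 + atPred (λ b → motzkin L b 0) a + 0 + 0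
      ≡⟨ trans (+-identityʳ _) (+-identityʳ _) ⟩
    motzkin L (suc a) 0 + atPred (λ b → motzkin L b 0) a
      ≡⟨ cong₂ _+_ (no-level-steps (suc a)) (atPred-cong no-level-steps a) ⟩
    dyck L (suc a) + atPred (dyck L) a
      ≡⟨ dyck-suc L a ⟨
    dyck (suc L) a
      ≡⟨ *-identityˡ _ ⟨
    1 * 1 * dyck (suc L) a
      ∎
    where
    no-level-steps : ∀ b → motzkin L b 0 ≡ dyck L b
    no-level-steps b = trans (motzkin≡binomial*dyck L b 0) (*-identityˡ _)
  motzkin≡binomial*dyck (suc L) a (suc j) = begin
    motzkin L (suc a) (suc j) + atPred (λ b → motzkin L b (suc j)) a + motzkin L a j + motzkin L a j
      ≡⟨ cong₂ _+_ (cong₂ _+_ (cong₂ _+_ (IH (suc a) (suc j)) (atPred-cong (λ b → IH b (suc j)) a))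
                              (IH a j)) (IH a j) ⟩
    c′ * 2P * dyck l′ (suc a) + atPred (λ b → c′ * 2P * dyck l′ b) a + c * P * d + c * P * d
      ≡⟨ cong (λ x → c′ * 2P * dyck l′ (suc a) + x + c * P * d + c * P * d)
              (atPred-scale (c′ * 2P) (dyck l′) a) ⟩
    c′ * 2P * dyck l′ (suc a) + c′ * 2P * atPred (dyck l′) a + c * P * d + c * P * d
      ≡⟨ factor c′ c P (dyck l′ (suc a)) (atPred (dyck l′) a) d ⟩
    c′ * 2P * (dyck l′ (suc a) + atPred (dyck l′) a) + c * 2P * d
      ≡⟨ cong (λ x → c′ * 2P * x + c * 2P * d) (dyck-suc l′ a) ⟨
    c′ * 2P * dyck (suc l′) a + c * 2P * d
      ≡⟨ cong (_+ c * 2P * d) (binomial-dyck-boundary L j a 2P) ⟩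
    c′ * 2P * d + c * 2P * d
      ≡⟨ collect c′ c 2P d ⟩
    (c + c′) * 2P * d
      ≡⟨ cong (λ x → x * 2P * d) (pascal L j) ⟨
    (suc L C suc j) * 2P * d
      ∎
    where
    IH = motzkin≡binomial*dyck L
    c = L C j
    c′ = L C suc j
    P = 2 ^ j
    2P = 2 ^ suc j
    l′ = L ∸ suc j
    d = dyck (L ∸ j) a
    factor : ∀ c′ c P u v d → c′ * (2 * P) * u + c′ * (2 * P) * v + c * P * d + c * P * d
                              ≡ c′ * (2 * P) * (u + v) + c * (2 * P) * d
    factor = solve-∀
    collect : ∀ c′ c Q d → c′ * Q * d + c * Q * d ≡ (c + c′) * Q * d
    collect = solve-∀

  -- motzkinTotal L a: bicoloured Motzkin paths of length L from height a to height 0.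
  motzkinTotal : ℕ → ℕ → ℕ
  motzkinTotal zero zero = 1
  motzkinTotal zero (suc a) = 0
  motzkinTotal (suc L) a =
    motzkinTotal L (suc a) + atPred (motzkinTotal L) a + motzkinTotal L a + motzkinTotal L a

  dyck-two-steps : ∀ l b →
    dyck (2 + l) (suc b) ≡ dyck l (3 + b) + atPred (dyck l) b + dyck l (suc b) + dyck l (suc b)
  dyck-two-steps l b = begin
    dyck (suc l) (2 + b) + dyck (suc l) b
      ≡⟨ cong (dyck (suc l) (2 + b) +_) (dyck-suc l b) ⟩
    dyck l (3 + b) + dyck l (suc b) + (dyck l (suc b) + atPred (dyck l) b)
      ≡⟨ regroup (dyck l (3 + b)) (dyck l (suc b)) (atPred (dyck l) b) ⟩
    dyck l (3 + b) + atPred (dyck l) b + dyck l (suc b) + dyck l (suc b)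
      ∎
    where
    regroup : ∀ x y z → x + y + (y + z) ≡ x + z + y + y
    regroup = solve-∀

  -- Read two steps at a time (UU, DD, UD, DU), a Dyck path becomes a bicoloured Motzkin path.
  motzkinTotal≡dyck : ∀ L a → motzkinTotal L a ≡ dyck (suc (L + L)) (suc (a + a))
  motzkinTotal≡dyck zero zero = refl
  motzkinTotal≡dyck zero (suc a) = dyck-out-of-reach 1 (suc (suc a + suc a)) (s≤s (s≤s z≤n))
  motzkinTotal≡dyck (suc L) a = begin
    M L (suc a) + atPred (M L) a + M L a + M L a
      ≡⟨ cong₂ _+_ (cong₂ _+_ (cong₂ _+_ (IH (suc a)) (atPred-cong IH a)) (IH a)) (IH a) ⟩
    dyck l (suc (suc a + suc a)) + atPred (λ b → dyck l (suc (b + b))) a + d + d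
      ≡⟨ cong₂ (λ x y → dyck l x + y + d + d) (cong (2 +_) (+-suc a a)) (atPred-double a) ⟩
    dyck l (3 + (a + a)) + atPred (dyck l) (a + a) + d + d
      ≡⟨ dyck-two-steps l (a + a) ⟨
    dyck (2 + l) (suc (a + a))
      ≡⟨ cong (λ n → dyck (suc n) (suc (a + a))) (+-suc (suc L) L) ⟨
    dyck (suc (suc L + suc L)) (suc (a + a))
      ∎
    where
    M = motzkinTotal
    IH = motzkinTotal≡dyck L
    l = suc (L + L)
    d = dyck l (suc (a + a))
    atPred-double : ∀ a → atPred (λ b → dyck l (suc (b + b))) a ≡ atPred (dyck l) (a + a)
    atPred-double zero = refl
    atPred-double (suc a) = cong (dyck l) (sym (+-suc a a))

module PlaneWalks where

  open import Data.Integer as ℤ using (ℤ; 1ℤ; _+_; _-_; -_)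
  open import Data.Integer.Tactic.RingSolver using (solve-∀)
  open import Data.List.Properties using (map-∘; map-cong; map-id)
  import Data.List.Relation.Unary.All.Properties as All

  X Y : Point → ℤ
  X = proj₁
  Y = proj₂

  visited : Point → List Step → List Point
  visited p [] = []
  visited p (s ∷ w) = move p s ∷ visited (move p s) w

  endFrom-++ : ∀ p u v → endFrom p (u ++ v) ≡ endFrom (endFrom p u) v
  endFrom-++ p [] v = refl
  endFrom-++ p (s ∷ u) v = endFrom-++ (move p s) u v

  visited-++ : ∀ p u v → visited p (u ++ v) ≡ visited p u ++ visited (endFrom p u) v
  visited-++ p [] v = refl
  visited-++ p (s ∷ u) v = cong (move p s ∷_) (visited-++ (move p s) u v)

  endFrom∈visited : ∀ p w → w ≢ [] → endFrom p w ∈ visited p w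
  endFrom∈visited p [] w≢[] = ⊥-elim (w≢[] refl)
  endFrom∈visited p (s ∷ []) _ = here refl
  endFrom∈visited p (s ∷ t ∷ w) _ = there (endFrom∈visited (move p s) (t ∷ w) λ ())

  endFrom∈start∷visited : ∀ p w → endFrom p w ∈ p ∷ visited p w
  endFrom∈start∷visited p [] = here refl
  endFrom∈start∷visited p (s ∷ w) = there (endFrom∈start∷visited (move p s) w)

  All-visited-++⁻ˡ : ∀ {Q : Point → Set} p u v → All Q (visited p (u ++ v)) → All Q (visited p u)
  All-visited-++⁻ˡ p u v = All.++⁻ˡ (visited p u) ∘ subst (All _) (visited-++ p u v)

  All-visited-++⁻ʳ : ∀ {Q : Point → Set} p u v →
                     All Q (visited p (u ++ v)) → All Q (visited (endFrom p u) v)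
  All-visited-++⁻ʳ p u v = All.++⁻ʳ (visited p u) ∘ subst (All _) (visited-++ p u v)

  All-visited-++⁺ : ∀ {Q : Point → Set} p u v →
                    All Q (visited p u) → All Q (visited (endFrom p u) v) → All Q (visited p (u ++ v))
  All-visited-++⁺ p u v Qu Qv = subst (All _) (sym (visited-++ p u v)) (All.++⁺ Qu Qv)

  record WalkMorphism : Set where
    field
      onPoint : Point → Point
      onStep : Step → Step
      move-commutes : ∀ p s → move (onPoint p) (onStep s) ≡ onPoint (move p s)

  module _ (φ : WalkMorphism) where
    open WalkMorphism φ

    endFrom-morphism : ∀ p w → endFrom (onPoint p) (map onStep w) ≡ onPoint (endFrom p w)
    endFrom-morphism p [] = refl
    endFrom-morphism p (s ∷ w) =
      trans (cong (λ q → endFrom q (map onStep w)) (move-commutes p s)) (endFrom-morphism (move p s) w)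

    visited-morphism : ∀ p w → visited (onPoint p) (map onStep w) ≡ map onPoint (visited p w)
    visited-morphism p [] = refl
    visited-morphism p (s ∷ w) rewrite move-commutes p s =
      cong (onPoint (move p s) ∷_) (visited-morphism (move p s) w)

    All-visited-morphism : ∀ {Q Q′ : Point → Set} {p p′} w → onPoint p ≡ p′ →
                           (∀ q → Q q → Q′ (onPoint q)) →
                           All Q (visited p w) → All Q′ (visited p′ (map onStep w))
    All-visited-morphism {Q′ = Q′} {p} w refl Q⇒Q′ Qw =
      subst (All Q′) (sym (visited-morphism p w)) (All.map⁺ (All.map (Q⇒Q′ _) Qw))

  _⊕_ : Point → Point → Point
  (x , y) ⊕ (a , b) = (x + a , y + b)

  private
    swap : ∀ x a c → x + a + c ≡ x + c + a
    swap = solve-∀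
    sub-sub : ∀ a y c → a - y - c ≡ a - (y + c)
    sub-sub = solve-∀

  translation : Point → WalkMorphism
  translation v@(a , b) = record { onPoint = _⊕ v ; onStep = id ; move-commutes = commutes }
    where
    commutes : ∀ p s → move (p ⊕ v) s ≡ move p s ⊕ v
    commutes (x , y) E = cong (_, y + b) (swap x a 1ℤ)
    commutes (x , y) W = cong (_, y + b) (swap x a (- 1ℤ))
    commutes (x , y) N = cong (x + a ,_) (swap y b 1ℤ)
    commutes (x , y) S = cong (x + a ,_) (swap y b (- 1ℤ))

  flipVertical : Step → Step
  flipVertical E = E
  flipVertical W = W
  flipVertical N = S
  flipVertical S = N

  flipVertical-involutive : ∀ w → map flipVertical (map flipVertical w) ≡ w
  flipVertical-involutive w = trans (sym (map-∘ w)) (trans (map-cong flip-flip w) (map-id w))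
    where
    flip-flip : ∀ s → flipVertical (flipVertical s) ≡ s
    flip-flip E = refl
    flip-flip W = refl
    flip-flip N = refl
    flip-flip S = refl

  mirror : Point → Point → Point
  mirror (a , b) (x , y) = (x + a , b - y)

  reflection : Point → WalkMorphism
  reflection c@(a , b) = record { onPoint = mirror c ; onStep = flipVertical ; move-commutes = commutes }
    where
    commutes : ∀ p s → move (mirror c p) (flipVertical s) ≡ mirror c (move p s)
    commutes (x , y) E = cong (_, b - y) (swap x a 1ℤ)
    commutes (x , y) W = cong (_, b - y) (swap x a (- 1ℤ))
    commutes (x , y) N = cong (x + a ,_) (sub-sub b y 1ℤ)
    commutes (x , y) S = cong (x + a ,_) (sub-sub b y (- 1ℤ))

  endFrom-translate : ∀ v p w → endFrom (p ⊕ v) w ≡ endFrom p w ⊕ v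
  endFrom-translate v p w =
    trans (cong (endFrom (p ⊕ v)) (sym (map-id w))) (endFrom-morphism (translation v) p w)

  All-visited-translate : ∀ {Q Q′ : Point → Set} v {p p′} w → p ⊕ v ≡ p′ →
                          (∀ q → Q q → Q′ (q ⊕ v)) →
                          All Q (visited p w) → All Q′ (visited p′ w)
  All-visited-translate {Q′ = Q′} v {p′ = p′} w eq Q⇒Q′ =
    subst (λ u → All Q′ (visited p′ u)) (map-id w) ∘ All-visited-morphism (translation v) w eq Q⇒Q′

module Cuts where

  open PlaneWalks
  open import Data.Integer as ℤ using (ℤ; _+_; _≤_; _<_; _<?_; _≟_)
  import Data.Integer.Properties as ℤ
  open import Data.List.Properties using (∷-injectiveˡ; ∷-injectiveʳ)
  import Data.List.Relation.Unary.All.Properties as All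
  import Data.Product as Product

  Cut : Set
  Cut = List Step × List Step

  cut-unique : (Spec : List Step → List Step → Set) →
               (∀ P M R → M ≢ [] → Spec P (M ++ R) → Spec (P ++ M) R → ⊥) →
               ∀ P R P′ R′ → P ++ R ≡ P′ ++ R′ → Spec P R → Spec P′ R′ → P ≡ P′ × R ≡ R′
  cut-unique Spec no-two [] R [] R′ eq _ _ = refl , eq
  cut-unique Spec no-two [] R (t ∷ P′) R′ refl spec spec′ =
    ⊥-elim (no-two [] (t ∷ P′) R′ (λ ()) spec spec′)
  cut-unique Spec no-two (s ∷ P) R [] R′ refl spec spec′ =
    ⊥-elim (no-two [] (s ∷ P) R (λ ()) spec′ spec)
  cut-unique Spec no-two (s ∷ P) R (t ∷ P′) R′ eq spec spec′ with refl ← ∷-injectiveˡ eq =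
    Product.map₁ (cong (s ∷_))
      (cut-unique (λ A B → Spec (s ∷ A) B) (λ P → no-two (s ∷ P))
                  P R P′ R′ (∷-injectiveʳ eq) spec spec′)

  record IsLeftmostCut (p : Point) (P R : List Step) : Set where
    field
      min≤start : X (endFrom p P) ≤ X p
      min≤prefix : All (λ q → X (endFrom p P) ≤ X q) (visited p P)
      min<suffix : All (λ q → X (endFrom p P) < X q) (visited (endFrom p P) R)

  leftmostCut-at : ∀ {p P R e} → endFrom p P ≡ e → X e ≤ X p →
                   All (λ q → X e ≤ X q) (visited p P) → All (λ q → X e < X q) (visited e R) →
                   IsLeftmostCut p P R
  leftmostCut-at refl start prefix suffix =
    record { min≤start = start ; min≤prefix = prefix ; min<suffix = suffix }

  leftmostCut : Point → List Step → Cut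
  leftmostCut p [] = [] , []
  leftmostCut p (s ∷ w) with leftmostCut (move p s) w
  ... | P , R with X p <? X (endFrom (move p s) P)
  ...   | yes _ = [] , s ∷ w
  ...   | no _ = s ∷ P , R

  CutsAtLeftmost : Point → List Step → Cut → Set
  CutsAtLeftmost p w (P , R) = P ++ R ≡ w × IsLeftmostCut p P R

  leftmostCut-correct : ∀ p w → CutsAtLeftmost p w (leftmostCut p w)
  leftmostCut-correct p [] = refl , record { min≤start = ℤ.≤-refl ; min≤prefix = [] ; min<suffix = [] }
  leftmostCut-correct p (s ∷ w) with leftmostCut (move p s) w | leftmostCut-correct (move p s) w
  ... | P , R | refl , cut with X p <? X (endFrom (move p s) P)
  ...   | yes p<m = refl , record
          { min≤start = ℤ.≤-refl
          ; min≤prefix = []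
          ; min<suffix = ℤ.<-≤-trans p<m min≤start
                       ∷ All-visited-++⁺ (move p s) P R (All.map (ℤ.<-≤-trans p<m) min≤prefix)
                                                       (All.map (ℤ.<-trans p<m) min<suffix)
          }
    where open IsLeftmostCut cut
  ...   | no p≮m = refl , record
          { min≤start = ℤ.≮⇒≥ p≮m
          ; min≤prefix = min≤start ∷ min≤prefix
          ; min<suffix = min<suffix
          }
    where open IsLeftmostCut cut

  leftmostCut-unique : ∀ p P R P′ R′ → P ++ R ≡ P′ ++ R′ →
                       IsLeftmostCut p P R → IsLeftmostCut p P′ R′ → P ≡ P′ × R ≡ R′
  leftmostCut-unique p = cut-unique (IsLeftmostCut p) no-two
    where
    no-two : ∀ P M R → M ≢ [] → IsLeftmostCut p P (M ++ R) → IsLeftmostCut p (P ++ M) R → ⊥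
    no-two P M R M≢[] cut cut′ = ℤ.<-irrefl refl (ℤ.<-≤-trans e<e′ e′≤e)
      where
      module C = IsLeftmostCut cut
      module C′ = IsLeftmostCut cut′
      e = endFrom p P
      e′≡ : endFrom p (P ++ M) ≡ endFrom e M
      e′≡ = endFrom-++ p P M
      e<e′ : X e < X (endFrom p (P ++ M))
      e<e′ = subst (λ q → X e < X q) (sym e′≡)
               (All.lookup (All-visited-++⁻ˡ e M R C.min<suffix) (endFrom∈visited e M M≢[]))
      e′≤e : X (endFrom p (P ++ M)) ≤ X e
      e′≤e = All.lookup (C′.min≤start ∷ All-visited-++⁻ˡ p P M C′.min≤prefix)
                        (endFrom∈start∷visited p P)

  leftmostCut-complete : ∀ p w P R → P ++ R ≡ w → IsLeftmostCut p P R → leftmostCut p w ≡ (P , R)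
  leftmostCut-complete p w P R refl cut with leftmostCut p w | leftmostCut-correct p w
  ... | P′ , R′ | eq , cut′ with leftmostCut-unique p P′ R′ P R eq cut′ cut
  ...   | refl , refl = refl

  -- The level of ordinate T/2, tested as 2y = T so that T need not be even.
  OnLevel : ℤ → Point → Set
  OnLevel T q = Y q + Y q ≡ T

  record IsLevelCut (T : ℤ) (p : Point) (A B : List Step) : Set where
    field
      nonempty : A ≢ []
      on-level : OnLevel T (endFrom p A)
      min≤prefix : All (λ q → OnLevel T q → X (endFrom p A) ≤ X q) (visited p A)
      min<suffix : All (λ q → OnLevel T q → X (endFrom p A) < X q) (visited (endFrom p A) B)

  levelCut-at : ∀ {T p A B a} → endFrom p A ≡ a → A ≢ [] → OnLevel T a →
                All (λ q → OnLevel T q → X a ≤ X q) (visited p A) →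
                All (λ q → OnLevel T q → X a < X q) (visited a B) →
                IsLevelCut T p A B
  levelCut-at refl A≢[] on prefix suffix =
    record { nonempty = A≢[] ; on-level = on ; min≤prefix = prefix ; min<suffix = suffix }

  levelCut : ℤ → Point → List Step → Maybe Cut
  levelCut T p [] = nothing
  levelCut T p (s ∷ w) with levelCut T (move p s) w | Y (move p s) + Y (move p s) ≟ T
  ... | nothing | yes _ = just (s ∷ [] , w)
  ... | nothing | no _ = nothing
  ... | just (A , B) | no _ = just (s ∷ A , B)
  ... | just (A , B) | yes _ with X (move p s) <? X (endFrom (move p s) A)
  ...   | yes _ = just (s ∷ [] , w)
  ...   | no _ = just (s ∷ A , B)

  CutsAtLevel : ℤ → Point → List Step → Maybe Cut → Set
  CutsAtLevel T p w nothing = All (λ q → ¬ OnLevel T q) (visited p w)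
  CutsAtLevel T p w (just (A , B)) = A ++ B ≡ w × IsLevelCut T p A B

  levelCut-correct : ∀ T p w → CutsAtLevel T p w (levelCut T p w)
  levelCut-correct T p [] = []
  levelCut-correct T p (s ∷ w)
    with levelCut T (move p s) w | levelCut-correct T (move p s) w | Y (move p s) + Y (move p s) ≟ T
  ... | nothing | off | yes on = refl , record
        { nonempty = λ ()
        ; on-level = on
        ; min≤prefix = (λ _ → ℤ.≤-refl) ∷ []
        ; min<suffix = All.map (λ off on → ⊥-elim (off on)) off
        }
  ... | nothing | off | no off₀ = off₀ ∷ off
  ... | just (A , B) | refl , cut | no off₀ = refl , record
        { nonempty = λ ()
        ; on-level = on-level
        ; min≤prefix = (λ on₀ → ⊥-elim (off₀ on₀)) ∷ min≤prefix
        ; min<suffix = min<suffix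
        }
    where open IsLevelCut cut
  ... | just (A , B) | refl , cut | yes on₀ with X (move p s) <? X (endFrom (move p s) A)
  ...   | yes m<a = refl , record
          { nonempty = λ ()
          ; on-level = on₀
          ; min≤prefix = (λ _ → ℤ.≤-refl) ∷ []
          ; min<suffix = All-visited-++⁺ (move p s) A B
                           (All.map (λ a≤ on → ℤ.<-≤-trans m<a (a≤ on)) min≤prefix)
                           (All.map (λ a< on → ℤ.<-trans m<a (a< on)) min<suffix)
          }
    where open IsLevelCut cut
  ...   | no m≮a = refl , record
          { nonempty = λ ()
          ; on-level = on-level
          ; min≤prefix = (λ _ → ℤ.≮⇒≥ m≮a) ∷ min≤prefix
          ; min<suffix = min<suffix
          }
    where open IsLevelCut cut

  levelCut-unique : ∀ T p A B A′ B′ → A ++ B ≡ A′ ++ B′ →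
                    IsLevelCut T p A B → IsLevelCut T p A′ B′ → A ≡ A′ × B ≡ B′
  levelCut-unique T p = cut-unique (IsLevelCut T p) no-two
    where
    no-two : ∀ A M B → M ≢ [] → IsLevelCut T p A (M ++ B) → IsLevelCut T p (A ++ M) B → ⊥
    no-two A M B M≢[] cut cut′ = ℤ.<-irrefl refl (ℤ.<-≤-trans a<a′ a′≤a)
      where
      module C = IsLevelCut cut
      module C′ = IsLevelCut cut′
      a = endFrom p A
      a′≡ : endFrom p (A ++ M) ≡ endFrom a M
      a′≡ = endFrom-++ p A M
      a<a′ : X a < X (endFrom p (A ++ M))
      a<a′ = subst (λ q → X a < X q) (sym a′≡)
               (All.lookup (All-visited-++⁻ˡ a M B C.min<suffix) (endFrom∈visited a M M≢[])
                           (subst (OnLevel T) a′≡ C′.on-level))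
      a′≤a : X (endFrom p (A ++ M)) ≤ X a
      a′≤a = All.lookup (All-visited-++⁻ˡ p A M C′.min≤prefix) (endFrom∈visited p A C.nonempty) C.on-level

  levelCut-complete : ∀ T p w A B → A ++ B ≡ w → IsLevelCut T p A B → levelCut T p w ≡ just (A , B)
  levelCut-complete T p w A B refl cut with levelCut T p w | levelCut-correct T p w
  ... | nothing | off =
    ⊥-elim (All.lookup (All-visited-++⁻ˡ p A B off) (endFrom∈visited p A nonempty) on-level)
    where open IsLevelCut cut
  ... | just (A′ , B′) | eq , cut′ with levelCut-unique T p A′ B′ A B eq cut′ cut
  ...   | refl , refl = refl

module SlitPlaneBijection where

  open PlaneWalks
  open Cuts
  open import Data.Nat as ℕ using (ℕ; suc)
  open import Data.Integer as ℤ using (ℤ; +_; 0ℤ; 1ℤ; _+_; _-_; -_; _≤_; _<_)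
  import Data.Integer.Properties as ℤ
  import Data.Nat.Properties as ℕ
  open import Data.Integer.Tactic.RingSolver using (solve-∀)

  OffSlit : Point → Set
  OffSlit q = Y q ≡ 0ℤ → 0ℤ < X q

  SlitWalk : List Step → Set
  SlitWalk w = All OffSlit (visited origin w) × endpoint w ≡ (1ℤ , 0ℤ)

  HalfPlaneWalk : List Step → Set
  HalfPlaneWalk h = All (λ q → 1ℤ ≤ X q) (visited origin h) × X (endpoint h) ≡ 1ℤ

  toHalfPlane : List Step → List Step
  toHalfPlane w = map flipVertical (proj₂ (leftmostCut origin w)) ++ proj₁ (leftmostCut origin w)

  toSlitPlane : List Step → List Step
  toSlitPlane h = maybe′ (λ (A , B) → B ++ map flipVertical A) h (levelCut (Y (endpoint h)) origin h)

  toHalfPlane-cut : ∀ {P R} → IsLeftmostCut origin P R → toHalfPlane (P ++ R) ≡ map flipVertical R ++ P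
  toHalfPlane-cut {P} {R} cut =
    cong (λ (P , R) → map flipVertical R ++ P) (leftmostCut-complete origin (P ++ R) P R refl cut)

  toSlitPlane-cut : ∀ {A B} → IsLevelCut (Y (endpoint (A ++ B))) origin A B →
                    toSlitPlane (A ++ B) ≡ B ++ map flipVertical A
  toSlitPlane-cut {A} {B} cut = cong (maybe′ (λ (A , B) → B ++ map flipVertical A) (A ++ B))
                                     (levelCut-complete _ origin (A ++ B) A B refl cut)

  private
    map-≢[] : ∀ {f : Step → Step} w → w ≢ [] → map f w ≢ []
    map-≢[] [] w≢[] = w≢[]
    map-≢[] (_ ∷ _) _ ()

    1≰0 : ¬ (1ℤ ≤ 0ℤ)
    1≰0 (ℤ.+≤+ ())

    0<⇒1≤ : ∀ {x} → 0ℤ < x → 1ℤ ≤ x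
    0<⇒1≤ = ℤ.i<j⇒suc[i]≤j

    1≤⇒0< : ∀ {x} → 1ℤ ≤ x → 0ℤ < x
    1≤⇒0< = ℤ.suc[i]≤j⇒i<j

    shift-≤ : ∀ {x y} k {l} → x + k ≡ l → x ≤ y → l ≤ y + k
    shift-≤ k refl x≤y = ℤ.+-monoˡ-≤ k x≤y

    shift-< : ∀ {x y} k {l} → x + k ≡ l → x < y → l < y + k
    shift-< k refl x<y = ℤ.+-monoˡ-< k x<y

    double-injective : ∀ {a b} → a + a ≡ b + b → a ≡ b
    double-injective {a} {b} eq = ℤ.*-cancelˡ-≡ (+ 2) a b (trans (double a) (trans eq (sym (double b))))
      where
      double : ∀ a → + 2 ℤ.* a ≡ a + a
      double = solve-∀

    level-of-mirror : ∀ {d y} → (d - y) + (d - y) ≡ d + d → y ≡ 0ℤ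
    level-of-mirror {d} {y} eq = begin
      y             ≡⟨ involution d y ⟩
      d - (d - y)   ≡⟨ cong (λ z → d - z) (double-injective {d - y} {d} eq) ⟩
      d - d         ≡⟨ ℤ.+-inverseʳ d ⟩
      0ℤ            ∎
      where
      open ≡-Reasoning
      involution : ∀ d y → y ≡ d - (d - y)
      involution = solve-∀

    level-of-translate : ∀ {y k} → (y + k) + (y + k) ≡ k + k → y ≡ 0ℤ
    level-of-translate {y} {k} eq = begin
      y             ≡⟨ add-sub y k ⟩
      (y + k) - k   ≡⟨ cong (_- k) (double-injective {y + k} {k} eq) ⟩
      k - k         ≡⟨ ℤ.+-inverseʳ k ⟩
      0ℤ            ∎
      where
      open ≡-Reasoning
      add-sub : ∀ y k → y ≡ (y + k) - k
      add-sub = solve-∀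

  module Forward {P R : List Step} (cut : IsLeftmostCut origin P R) (slit : SlitWalk (P ++ R)) where
    open IsLeftmostCut cut

    e = endFrom origin P
    c = X e
    d = Y e
    m : Point
    m = (- c , d)
    a : Point
    a = (1ℤ + - c , d)

    mirror-e : mirror m e ≡ origin
    mirror-e = cong₂ _,_ (ℤ.+-inverseʳ c) (ℤ.+-inverseʳ d)

    origin⊕a : origin ⊕ a ≡ a
    origin⊕a = cong₂ _,_ (ℤ.+-identityˡ _) (ℤ.+-identityˡ _)

    σR = map flipVertical R

    R-ends : endFrom e R ≡ (1ℤ , 0ℤ)
    R-ends = trans (sym (endFrom-++ origin P R)) (proj₂ slit)

    σR-ends : endFrom origin σR ≡ a
    σR-ends = trans (cong (λ q → endFrom q σR) (sym mirror-e))
                    (trans (endFrom-morphism (reflection m) e R) (trans (cong (mirror m) R-ends) mirror-end))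
      where
      mirror-end : mirror m (1ℤ , 0ℤ) ≡ a
      mirror-end = cong (1ℤ + - c ,_) (ℤ.+-identityʳ d)

    image-ends : endpoint (σR ++ P) ≡ (1ℤ , d + d)
    image-ends = begin
      endpoint (σR ++ P)            ≡⟨ endFrom-++ origin σR P ⟩
      endFrom (endFrom origin σR) P ≡⟨ cong (λ q → endFrom q P) (trans σR-ends (sym origin⊕a)) ⟩
      endFrom (origin ⊕ a) P        ≡⟨ endFrom-translate a origin P ⟩
      e ⊕ a                         ≡⟨ cong (_, d + d) (cancel c) ⟩
      (1ℤ , d + d)                  ∎
      where
      open ≡-Reasoning
      cancel : ∀ c → c + (1ℤ + - c) ≡ 1ℤ
      cancel = solve-∀

    R≢[] : R ≢ []
    R≢[] refl = 1≰0 (subst (λ q → X q ≤ 0ℤ) R-ends min≤start)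

    half-plane : HalfPlaneWalk (σR ++ P)
    half-plane = All-visited-++⁺ origin σR P σR-right P-right , cong X image-ends
      where
      σR-right : All (λ q → 1ℤ ≤ X q) (visited origin σR)
      σR-right = All-visited-morphism (reflection m) R mirror-e
                   (λ q c<x → shift-≤ (- c) (suc-cancel c) (ℤ.i<j⇒suc[i]≤j c<x)) min<suffix
        where
        suc-cancel : ∀ c → 1ℤ + c + - c ≡ 1ℤ
        suc-cancel = solve-∀
      P-right : All (λ q → 1ℤ ≤ X q) (visited (endFrom origin σR) P)
      P-right = All-visited-translate a P (trans origin⊕a (sym σR-ends))
                  (λ q c≤x → shift-≤ (1ℤ + - c) (cancel c) c≤x) min≤prefix
        where
        cancel : ∀ c → c + (1ℤ + - c) ≡ 1ℤ
        cancel = solve-∀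

    level-cut : IsLevelCut (Y (endpoint (σR ++ P))) origin σR P
    level-cut = subst (λ T → IsLevelCut T origin σR P) (sym (cong Y image-ends))
                  (levelCut-at σR-ends σR≢[] refl prefix suffix)
      where
      σR≢[] : σR ≢ []
      σR≢[] = map-≢[] R R≢[]
      prefix : All (λ q → OnLevel (d + d) q → X a ≤ X q) (visited origin σR)
      prefix = All-visited-morphism (reflection m) R mirror-e
                 (λ q off on → ℤ.+-monoˡ-≤ (- c) (0<⇒1≤ (off (level-of-mirror {d} on))))
                 (All-visited-++⁻ʳ origin P R (proj₁ slit))
      suffix : All (λ q → OnLevel (d + d) q → X a < X q) (visited a P)
      suffix = All-visited-translate a P origin⊕a
                 (λ q off on → shift-< (1ℤ + - c) (ℤ.+-identityˡ _) (off (level-of-translate on)))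
                 (All-visited-++⁻ˡ origin P R (proj₁ slit))

  module Backward {A B : List Step} (cut : IsLevelCut (Y (endpoint (A ++ B))) origin A B)
                  (half : HalfPlaneWalk (A ++ B)) where
    open IsLevelCut cut

    a = endFrom origin A
    ε = endpoint (A ++ B)
    n : Point
    n = (- X a , - Y a)
    e′ = ε ⊕ n
    σA = map flipVertical A

    a⊕n : a ⊕ n ≡ origin
    a⊕n = cong₂ _,_ (ℤ.+-inverseʳ (X a)) (ℤ.+-inverseʳ (Y a))

    mirror-origin : mirror e′ origin ≡ e′
    mirror-origin = cong₂ _,_ (ℤ.+-identityˡ _) (ℤ.+-identityʳ _)

    B-ends : endFrom origin B ≡ e′
    B-ends = trans (cong (λ q → endFrom q B) (sym a⊕n))
                   (trans (endFrom-translate n a B) (cong (_⊕ n) (sym (endFrom-++ origin A B))))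

    Ye′≡Ya : Y e′ ≡ Y a
    Ye′≡Ya = trans (cong (_- Y a) (sym on-level)) (add-sub (Y a))
      where
      add-sub : ∀ y → y + y - y ≡ y
      add-sub = solve-∀

    Xε≡1 : X ε ≡ 1ℤ
    Xε≡1 = proj₂ half

    Xa+Xe′≡1 : X a + X e′ ≡ 1ℤ
    Xa+Xe′≡1 = trans (cancel (X a) (X ε)) Xε≡1
      where
      cancel : ∀ x t → x + (t + - x) ≡ t
      cancel = solve-∀

    image-ends : endpoint (B ++ σA) ≡ (1ℤ , 0ℤ)
    image-ends = begin
      endpoint (B ++ σA)
        ≡⟨ endFrom-++ origin B σA ⟩
      endFrom (endFrom origin B) σA
        ≡⟨ cong (λ q → endFrom q σA) (trans B-ends (sym mirror-origin)) ⟩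
      endFrom (mirror e′ origin) σA
        ≡⟨ endFrom-morphism (reflection e′) origin A ⟩
      mirror e′ a
        ≡⟨ cong₂ _,_ Xa+Xe′≡1 (trans (cong (_- Y a) Ye′≡Ya) (ℤ.+-inverseʳ (Y a))) ⟩
      (1ℤ , 0ℤ)
        ∎
      where open ≡-Reasoning

    right : All (λ q → 1ℤ ≤ X q) (visited origin (A ++ B))
    right = proj₁ half

    on-level-of : ∀ q → Y q ≡ Y a → OnLevel (Y ε) q
    on-level-of q eq = trans (cong₂ _+_ eq eq) on-level

    slit : SlitWalk (B ++ σA)
    slit = All-visited-++⁺ origin B σA B-off σA-off , image-ends
      where
      B-off : All OffSlit (visited origin B)
      B-off = All-visited-translate n B a⊕n
                (λ q a<q y≡0 → shift-< (- X a) (ℤ.+-inverseʳ (X a))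
                                  (a<q (on-level-of q (ℤ.i-j≡0⇒i≡j _ _ y≡0))))
                min<suffix
      σA-off : All OffSlit (visited (endFrom origin B) σA)
      σA-off = All-visited-morphism (reflection e′) A (trans mirror-origin (sym B-ends))
                 (λ q a≤q y≡0 → 1≤⇒0< (shift-≤ (X e′) Xa+Xe′≡1
                   (a≤q (on-level-of q (trans (sym (ℤ.i-j≡0⇒i≡j _ _ y≡0)) Ye′≡Ya)))))
                 min≤prefix

    leftmost-cut : IsLeftmostCut origin B σA
    leftmost-cut = leftmostCut-at B-ends start prefix suffix
      where
      1-Xa≡Xe′ : 1ℤ + - X a ≡ X e′
      1-Xa≡Xe′ = cong (_+ - X a) (sym Xε≡1)
      start : X e′ ≤ 0ℤ
      start = subst (X e′ ≤_) (ℤ.+-inverseʳ (X a)) (shift-≤ (- X a) 1-Xa≡Xe′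
                (All.lookup (All-visited-++⁻ˡ origin A B right) (endFrom∈visited origin A nonempty)))
      prefix : All (λ q → X e′ ≤ X q) (visited origin B)
      prefix = All-visited-translate n B a⊕n (λ q → shift-≤ (- X a) 1-Xa≡Xe′)
                 (All-visited-++⁻ʳ origin A B right)
      suffix : All (λ q → X e′ < X q) (visited e′ σA)
      suffix = All-visited-morphism (reflection e′) A mirror-origin
                 (λ q 1≤q → shift-< (X e′) (ℤ.+-identityˡ _) (1≤⇒0< 1≤q))
                 (All-visited-++⁻ˡ origin A B right)

  step-parity : ∀ p s → ∃[ i ] X (move p s) + Y (move p s) ≡ X p + Y p + 1ℤ + (i + i)
  step-parity (x , y) E = 0ℤ , east x y
    where
    east : ∀ x y → x + 1ℤ + y ≡ x + y + 1ℤ + (0ℤ + 0ℤ)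
    east = solve-∀
  step-parity (x , y) W = - 1ℤ , west x y
    where
    west : ∀ x y → x - 1ℤ + y ≡ x + y + 1ℤ + (- 1ℤ + - 1ℤ)
    west = solve-∀
  step-parity (x , y) N = 0ℤ , north x y
    where
    north : ∀ x y → x + (y + 1ℤ) ≡ x + y + 1ℤ + (0ℤ + 0ℤ)
    north = solve-∀
  step-parity (x , y) S = - 1ℤ , south x y
    where
    south : ∀ x y → x + (y - 1ℤ) ≡ x + y + 1ℤ + (- 1ℤ + - 1ℤ)
    south = solve-∀

  walk-parity : ∀ p w → ∃[ j ] X (endFrom p w) + Y (endFrom p w) ≡ X p + Y p + + length w + (j + j)
  walk-parity p [] = 0ℤ , no-steps (X p) (Y p)
    where
    no-steps : ∀ x y → x + y ≡ x + y + 0ℤ + (0ℤ + 0ℤ)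
    no-steps = solve-∀
  walk-parity p (s ∷ w) with step-parity p s | walk-parity (move p s) w
  ... | i , first | j , rest = i + j , trans rest (trans (cong (λ z → z + + length w + (j + j)) first)
                                                           (regroup (X p + Y p) (+ length w) i j))
    where
    regroup : ∀ z L i j → z + 1ℤ + (i + i) + L + (j + j) ≡ z + (1ℤ + L) + ((i + j) + (i + j))
    regroup = solve-∀

  ordinate-even : ∀ n h → length h ≡ suc (n ℕ.+ n) → X (endpoint h) ≡ 1ℤ → ∃[ k ] Y (endpoint h) ≡ k + k
  ordinate-even n h len x≡1 with walk-parity origin h
  ... | j , parity = + n + j , (begin
    y                                       ≡⟨ add-sub y ⟩
    1ℤ + y - 1ℤ                             ≡⟨ cong (λ x → x + y - 1ℤ) x≡1 ⟨
    X (endpoint h) + y - 1ℤ                 ≡⟨ cong (_- 1ℤ) parity ⟩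
    0ℤ + 0ℤ + + length h + (j + j) - 1ℤ      ≡⟨ cong (λ L → 0ℤ + 0ℤ + + L + (j + j) - 1ℤ) len ⟩
    0ℤ + 0ℤ + (1ℤ + (+ n + + n)) + (j + j) - 1ℤ ≡⟨ halve (+ n) j ⟩
    (+ n + j) + (+ n + j)                   ∎)
    where
    open ≡-Reasoning
    y = Y (endpoint h)
    add-sub : ∀ y → y ≡ 1ℤ + y - 1ℤ
    add-sub = solve-∀
    halve : ∀ n j → 0ℤ + 0ℤ + (1ℤ + (n + n)) + (j + j) - 1ℤ ≡ (n + j) + (n + j)
    halve = solve-∀

  ordinate-stays-below : ∀ k p w → All (λ q → Y q ≢ k) (visited p w) → Y p < k → Y (endFrom p w) < k
  ordinate-stays-below k p [] _ y<k = y<k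
  ordinate-stays-below k p (E ∷ w) (_ ∷ off) y<k = ordinate-stays-below k _ w off y<k
  ordinate-stays-below k p (W ∷ w) (_ ∷ off) y<k = ordinate-stays-below k _ w off y<k
  ordinate-stays-below k p (N ∷ w) (y+1≢k ∷ off) y<k = ordinate-stays-below k _ w off
    (ℤ.≤∧≢⇒< (subst (_≤ k) (ℤ.+-comm 1ℤ (Y p)) (ℤ.i<j⇒suc[i]≤j y<k)) y+1≢k)
  ordinate-stays-below k p (S ∷ w) (_ ∷ off) y<k = ordinate-stays-below k _ w off
    (ℤ.<-trans (ℤ.i≤pred[j]⇒i<j (ℤ.≤-reflexive (ℤ.+-comm (Y p) (- 1ℤ)))) y<k)

  ordinate-stays-above : ∀ k p w → All (λ q → Y q ≢ k) (visited p w) → k < Y p → k < Y (endFrom p w)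
  ordinate-stays-above k p [] _ k<y = k<y
  ordinate-stays-above k p (E ∷ w) (_ ∷ off) k<y = ordinate-stays-above k _ w off k<y
  ordinate-stays-above k p (W ∷ w) (_ ∷ off) k<y = ordinate-stays-above k _ w off k<y
  ordinate-stays-above k p (N ∷ w) (_ ∷ off) k<y = ordinate-stays-above k _ w off
    (ℤ.<-trans k<y (ℤ.suc[i]≤j⇒i<j (ℤ.≤-reflexive (ℤ.+-comm 1ℤ (Y p)))))
  ordinate-stays-above k p (S ∷ w) (y-1≢k ∷ off) k<y = ordinate-stays-above k _ w off
    (ℤ.≤∧≢⇒< (subst (k ≤_) (ℤ.+-comm (- 1ℤ) (Y p)) (ℤ.i<j⇒i≤pred[j] k<y)) (y-1≢k ∘ sym))

  -- An odd walk ending on x = 1 ends at an even ordinate 2k, so it must cross the level k.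
  visits-middle-level : ∀ n h → length h ≡ suc (n ℕ.+ n) → X (endpoint h) ≡ 1ℤ →
                        ¬ All (λ q → ¬ OnLevel (Y (endpoint h)) q) (visited origin h)
  visits-middle-level n h len x≡1 off with ordinate-even n h len x≡1
  ... | k , y≡2k with ℤ.<-cmp 0ℤ k
  ...   | tri< 0<k _ _ = ℤ.<-asym (ordinate-stays-below k origin h off′ 0<k)
                           (subst (k <_) (sym y≡2k) (shift-< k (ℤ.+-identityˡ k) 0<k))
    where off′ = All.map (λ ¬on y≡k → ¬on (trans (cong₂ _+_ y≡k y≡k) (sym y≡2k))) off
  ...   | tri≈ _ refl _ =
    All.lookup off (endFrom∈visited origin h h≢[]) (trans (cong₂ _+_ y≡2k y≡2k) (sym y≡2k))
    where
    h≢[] : h ≢ []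
    h≢[] h≡[] = ℕ.0≢1+n (trans (cong length (sym h≡[])) len)
  ...   | tri> _ _ k<0 = ℤ.<-asym (ordinate-stays-above k origin h off′ k<0)
                           (subst (_< k) (sym y≡2k) (subst (k + k <_) (ℤ.+-identityˡ k) (ℤ.+-monoˡ-< k k<0)))
    where off′ = All.map (λ ¬on y≡k → ¬on (trans (cong₂ _+_ y≡k y≡k) (sym y≡2k))) off

  toHalfPlane-inverse : ∀ w → SlitWalk w → HalfPlaneWalk (toHalfPlane w) × toSlitPlane (toHalfPlane w) ≡ w
  toHalfPlane-inverse w slit with leftmostCut origin w | leftmostCut-correct origin w
  ... | P , R | refl , cut =
    F.half-plane , trans (toSlitPlane-cut F.level-cut) (cong (P ++_) (flipVertical-involutive R))
    where module F = Forward cut slit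

  toSlitPlane-inverse : ∀ n h → length h ≡ suc (n ℕ.+ n) → HalfPlaneWalk h →
                        SlitWalk (toSlitPlane h) × toHalfPlane (toSlitPlane h) ≡ h
  toSlitPlane-inverse n h len half
    with levelCut (Y (endpoint h)) origin h | levelCut-correct (Y (endpoint h)) origin h
  ... | nothing | off = ⊥-elim (visits-middle-level n h len (proj₂ half) off)
  ... | just (A , B) | refl , cut =
    Bk.slit , trans (toHalfPlane-cut Bk.leftmost-cut) (cong (_++ B) (flipVertical-involutive A))
    where module Bk = Backward cut half

  module _ (stat : List Step → ℕ) (stat-++ : ∀ u v → stat (u ++ v) ≡ stat u ℕ.+ stat v)
           (stat-flip : ∀ u → stat (map flipVertical u) ≡ stat u) where

    stat-swap : ∀ u v → stat (u ++ v) ≡ stat (v ++ u)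
    stat-swap u v = trans (stat-++ u v) (trans (ℕ.+-comm (stat u) (stat v)) (sym (stat-++ v u)))

    stat-flip-++ : ∀ u v → stat (map flipVertical u ++ v) ≡ stat (u ++ v)
    stat-flip-++ u v = trans (stat-++ _ v) (trans (cong (ℕ._+ stat v) (stat-flip u)) (sym (stat-++ u v)))

    toHalfPlane-invariant : ∀ w → stat (toHalfPlane w) ≡ stat w
    toHalfPlane-invariant w =
      trans (stat-flip-++ R P) (trans (stat-swap R P) (cong stat (proj₁ (leftmostCut-correct origin w))))
      where
      P = proj₁ (leftmostCut origin w)
      R = proj₂ (leftmostCut origin w)

    toSlitPlane-invariant : ∀ h → stat (toSlitPlane h) ≡ stat h
    toSlitPlane-invariant h
      with levelCut (Y (endpoint h)) origin h | levelCut-correct (Y (endpoint h)) origin h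
    ... | nothing | _ = refl
    ... | just (A , B) | A++B≡h , _ =
      trans (stat-swap B (map flipVertical A)) (trans (stat-flip-++ A B) (cong stat A++B≡h))

module WalkPredicates where

  open PlaneWalks
  open SlitPlaneBijection
  open import Data.Integer as ℤ using (ℤ; 0ℤ; 1ℤ; _≤?_; _≟_)
  import Data.Integer.Properties as ℤ
  open import Data.Product.Function.NonDependent.Propositional using (_×-⇔_)
  import Data.List.Relation.Unary.All.Properties as All
  import Function.Properties.Equivalence as ⇔

  All-∷-⇔ : ∀ {Q : Point → Set} {q qs} → (Q q × All Q qs) ⇔ All Q (q ∷ qs)
  All-∷-⇔ = mk⇔ (λ (q , qs) → q ∷ qs) All.uncons

  rightOfAxisFrom : Point → List Step → Bool
  rightOfAxisFrom p [] = true
  rightOfAxisFrom p (s ∷ w) = ⌊ 1ℤ ≤? X (move p s) ⌋ ∧ rightOfAxisFrom (move p s) w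

  halfPlane : Point → List Step → Bool
  halfPlane p w = rightOfAxisFrom p w ∧ ⌊ X (endFrom p w) ≟ 1ℤ ⌋

  rightOfAxis-reflects : ∀ p w → T (rightOfAxisFrom p w) ⇔ All (λ q → 1ℤ ℤ.≤ X q) (visited p w)
  rightOfAxis-reflects p [] = mk⇔ (λ _ → []) _
  rightOfAxis-reflects p (s ∷ w) =
    ⇔.trans T-∧ (⇔.trans (mk⇔ toWitness fromWitness ×-⇔ rightOfAxis-reflects (move p s) w) All-∷-⇔)

  halfPlane-reflects : ∀ w → T (halfPlane origin w) ⇔ HalfPlaneWalk w
  halfPlane-reflects w = ⇔.trans T-∧ (rightOfAxis-reflects origin w ×-⇔ mk⇔ toWitness fromWitness)

  offSlit-reflects : ∀ q → T (not (onH q)) ⇔ OffSlit q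
  offSlit-reflects (x , y) with y ≟ 0ℤ | x ≤? 0ℤ
  ... | yes y≡0 | yes x≤0 = mk⇔ (λ ()) (λ off → ℤ.<⇒≱ (off y≡0) x≤0)
  ... | yes _ | no x≰0 = mk⇔ (λ _ _ → ℤ.≰⇒> x≰0) _
  ... | no y≢0 | _ = mk⇔ (λ _ y≡0 → ⊥-elim (y≢0 y≡0)) _

  avoidsH-reflects : ∀ p w → T (avoidsHFrom p w) ⇔ All OffSlit (visited p w)
  avoidsH-reflects p [] = mk⇔ (λ _ → []) _
  avoidsH-reflects p (s ∷ w) =
    ⇔.trans T-∧ (⇔.trans (offSlit-reflects (move p s) ×-⇔ avoidsH-reflects (move p s) w) All-∷-⇔)

  endsAt-reflects : ∀ w → T (endsAt point10 w) ⇔ (endpoint w ≡ (1ℤ , 0ℤ))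
  endsAt-reflects w = ⇔.trans T-∧
    (mk⇔ (λ (x , y) → cong₂ _,_ (toWitness {a? = x?} x) (toWitness {a? = y?} y))
         (λ e → fromWitness (cong proj₁ e) , fromWitness (cong proj₂ e)))
    where
    x? = X (endpoint w) ≟ 1ℤ
    y? = Y (endpoint w) ≟ 0ℤ

  slitWalk-reflects : ∀ w → T (onSlitPlane w ∧ endsAt point10 w) ⇔ SlitWalk w
  slitWalk-reflects w = ⇔.trans T-∧ (avoidsH-reflects origin w ×-⇔ endsAt-reflects w)

module Recurrences where

  open Enumeration
  open LatticePathNumbers
  open PlaneWalks using (X; Y)
  open WalkPredicates
  open import Data.Nat using (ℕ; zero; suc; _+_)
  open import Data.Nat.Properties using (_≟_; +-comm; +-identityʳ; suc-injective)
  open import Data.Nat.Tactic.RingSolver using (solve-∀)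
  open import Data.Integer as ℤ using (+_; -[1+_]; 0ℤ; 1ℤ)
  open import Data.Bool.Properties using (∧-zeroʳ)
  open ≡-Reasoning

  suc≟suc : ∀ c j → ⌊ suc c ≟ suc j ⌋ ≡ ⌊ c ≟ j ⌋
  suc≟suc c j with c ≟ j | suc c ≟ suc j
  ... | yes _ | yes _ = refl
  ... | no _ | no _ = refl
  ... | yes c≡j | no 1+c≢1+j = ⊥-elim (1+c≢1+j (cong suc c≡j))
  ... | no c≢j | yes 1+c≡1+j = ⊥-elim (c≢j (suc-injective 1+c≡1+j))

  numWalks-counted-step : ∀ L (P : List Step → Bool) (c : List Step → ℕ) j →
    numWalks L (λ w → P w ∧ ⌊ suc (c w) ≟ j ⌋)
      ≡ atPred (λ j → numWalks L (λ w → P w ∧ ⌊ c w ≟ j ⌋)) j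
  numWalks-counted-step L P c zero = numWalks-none L (λ w → ∧-zeroʳ (P w))
  numWalks-counted-step L P c (suc j) = numWalks-cong L (λ w → cong (P w ∧_) (suc≟suc (c w) j))

  halfPlaneVerticals : Point → ℕ → List Step → Bool
  halfPlaneVerticals p j w = halfPlane p w ∧ ⌊ countSteps isVertical w ≟ j ⌋

  -- The abscissa a + 1 is the height a; E and W are the up and down steps, N and S the level steps.
  numWalks-halfPlaneVerticals : ∀ L a y j → numWalks L (halfPlaneVerticals (+ suc a , y) j) ≡ motzkin L a j
  numWalks-halfPlaneVerticals zero zero y zero = refl
  numWalks-halfPlaneVerticals zero zero y (suc j) = refl
  numWalks-halfPlaneVerticals zero (suc a) y zero = refl
  numWalks-halfPlaneVerticals zero (suc a) y (suc j) = refl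
  numWalks-halfPlaneVerticals (suc L) a y j = trans (numWalks-suc L H)
    (cong₂ _+_ (cong₂ _+_ (cong₂ _+_ east (west a)) (vertical (y ℤ.+ 1ℤ))) (vertical (y ℤ.- 1ℤ)))
    where
    IH = numWalks-halfPlaneVerticals L
    H = halfPlaneVerticals (+ suc a , y) j
    east : numWalks L (H ∘ (E ∷_)) ≡ motzkin L (suc a) j
    east = trans (numWalks-cong L (λ w → cong (λ b → halfPlaneVerticals (+ suc b , y) j w) (+-comm a 1)))
                 (IH (suc a) y j)
    west : ∀ a → numWalks L (halfPlaneVerticals (+ suc a , y) j ∘ (W ∷_)) ≡ atPred (λ b → motzkin L b j) a
    west zero = numWalks-none L (λ _ → refl)
    west (suc a) = IH a y j
    vertical : ∀ y′ →
      numWalks L (λ w → halfPlane (+ suc a , y′) w ∧ ⌊ suc (countSteps isVertical w) ≟ j ⌋)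
        ≡ atPred (motzkin L a) j
    vertical y′ = trans (numWalks-counted-step L (halfPlane (+ suc a , y′)) (countSteps isVertical) j)
                        (atPred-cong (λ j → IH a y′ j) j)

  numWalks-halfPlane : ∀ L a y → numWalks L (halfPlane (+ suc a , y)) ≡ motzkinTotal L a
  numWalks-halfPlane zero zero y = refl
  numWalks-halfPlane zero (suc a) y = refl
  numWalks-halfPlane (suc L) a y = trans (numWalks-suc L H)
    (cong₂ _+_ (cong₂ _+_ (cong₂ _+_ east (west a)) (IH a (y ℤ.+ 1ℤ))) (IH a (y ℤ.- 1ℤ)))
    where
    IH = numWalks-halfPlane L
    H = halfPlane (+ suc a , y)
    east : numWalks L (H ∘ (E ∷_)) ≡ motzkinTotal L (suc a)
    east = trans (numWalks-cong L (λ w → cong (λ b → halfPlane (+ suc b , y) w) (+-comm a 1))) (IH (suc a) y)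
    west : ∀ a → numWalks L (halfPlane (+ suc a , y) ∘ (W ∷_)) ≡ atPred (motzkinTotal L) a
    west zero = numWalks-none L (λ _ → refl)
    west (suc a) = IH a y

  motzkinHorizontals : Point → ℕ → List Step → Bool
  motzkinHorizontals p j w =
    (⌊ Y (endFrom p w) ℤ.≟ 0ℤ ⌋ ∧ nonNegFrom p w) ∧ ⌊ countSteps isHorizontal w ≟ j ⌋

  numWalks-motzkinHorizontals : ∀ L x a j → numWalks L (motzkinHorizontals (x , + a) j) ≡ motzkin L a j
  numWalks-motzkinHorizontals zero x zero zero = refl
  numWalks-motzkinHorizontals zero x zero (suc j) = refl
  numWalks-motzkinHorizontals zero x (suc a) zero = refl
  numWalks-motzkinHorizontals zero x (suc a) (suc j) = refl
  numWalks-motzkinHorizontals (suc L) x a j = begin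
    numWalks (suc L) M
      ≡⟨ numWalks-suc L M ⟩
    _
      ≡⟨ cong₂ _+_ (cong₂ _+_ (cong₂ _+_ (horizontal (x ℤ.+ 1ℤ)) (horizontal (x ℤ.- 1ℤ))) north) (south a) ⟩
    atPred (motzkin L a) j + atPred (motzkin L a) j + motzkin L (suc a) j + atPred (λ b → motzkin L b j) a
      ≡⟨ regroup (atPred (motzkin L a) j) (motzkin L (suc a) j) (atPred (λ b → motzkin L b j) a) ⟩
    motzkin (suc L) a j
      ∎
    where
    IH = numWalks-motzkinHorizontals L
    M = motzkinHorizontals (x , + a) j
    horizontal : ∀ x′ →
      numWalks L (λ w → (⌊ Y (endFrom (x′ , + a) w) ℤ.≟ 0ℤ ⌋ ∧ nonNegFrom (x′ , + a) w)
                        ∧ ⌊ suc (countSteps isHorizontal w) ≟ j ⌋)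
        ≡ atPred (motzkin L a) j
    horizontal x′ = trans (numWalks-counted-step L _ (countSteps isHorizontal) j) (atPred-cong (IH x′ a) j)
    north : numWalks L (M ∘ (N ∷_)) ≡ motzkin L (suc a) j
    north = trans (numWalks-cong L (λ w → cong (λ b → motzkinHorizontals (x , + b) j w) (+-comm a 1)))
                  (IH x (suc a) j)
    south : ∀ a → numWalks L (motzkinHorizontals (x , + a) j ∘ (S ∷_)) ≡ atPred (λ b → motzkin L b j) a
    south zero = numWalks-none L below-axis
      where
      below-axis : ∀ w → motzkinHorizontals (x , -[1+ 0 ]) j w ≡ false
      below-axis [] = refl
      below-axis w@(_ ∷ _) =
        cong (_∧ ⌊ countSteps isHorizontal w ≟ j ⌋) (∧-zeroʳ ⌊ Y (endFrom (x , -[1+ 0 ]) w) ℤ.≟ 0ℤ ⌋)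
    south (suc a) = IH x a j
    regroup : ∀ v u d → v + v + u + d ≡ u + d + v + v
    regroup = solve-∀

  halfPlane-first-step : ∀ L (K : List Step → Bool) →
    numWalks (suc L) (λ w → halfPlane origin w ∧ K w)
      ≡ numWalks L (λ w → halfPlane (+ 1 , 0ℤ) w ∧ K (E ∷ w))
  halfPlane-first-step L K = begin
    numWalks (suc L) H
      ≡⟨ numWalks-suc L H ⟩
    numWalks L (H ∘ (E ∷_)) + numWalks L (H ∘ (W ∷_)) + numWalks L (H ∘ (N ∷_)) + numWalks L (H ∘ (S ∷_))
      ≡⟨ cong₂ _+_ (cong₂ _+_ (cong (λ z → numWalks L (H ∘ (E ∷_)) + z) (numWalks-none L λ _ → refl))
                              (numWalks-none L λ _ → refl))
                   (numWalks-none L λ _ → refl) ⟩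
    numWalks L (H ∘ (E ∷_)) + 0 + 0 + 0
      ≡⟨ trans (+-identityʳ _) (trans (+-identityʳ _) (+-identityʳ _)) ⟩
    numWalks L (H ∘ (E ∷_))
      ∎
    where
    H = λ w → halfPlane origin w ∧ K w

open Enumeration
open LatticePathNumbers
open PlaneWalks using (flipVertical)
open SlitPlaneBijection
open WalkPredicates
open Recurrences
open import Data.Nat using (ℕ; suc; _+_; _*_; _∸_; _^_; _≤_)
open import Data.Nat.Properties using (_≟_; +-assoc; +-comm; +-identityʳ; *-distribˡ-∸; ^-*-assoc)
open import Data.Integer using (0ℤ; 1ℤ)
open import Data.Nat.Combinatorics using (_C_)
open import Data.Nat.Tactic.RingSolver using (solve-∀)
open import Data.List.Properties using (length-++; length-map)
open import Data.Bool.Properties using (∧-assoc; ∧-identityʳ)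
open ≡-Reasoning

countSteps-++ : ∀ p u v → countSteps p (u ++ v) ≡ countSteps p u + countSteps p v
countSteps-++ p [] v = refl
countSteps-++ p (s ∷ u) v = trans (cong (b +_) (countSteps-++ p u v)) (sym (+-assoc b (countSteps p u) _))
  where b = Bool.if p s then 1 else 0

countSteps-map : ∀ p f → (∀ s → p (f s) ≡ p s) → ∀ u → countSteps p (map f u) ≡ countSteps p u
countSteps-map p f p∘f≗p [] = refl
countSteps-map p f p∘f≗p (s ∷ u) =
  cong₂ (λ b n → (Bool.if b then 1 else 0) + n) (p∘f≗p s) (countSteps-map p f p∘f≗p u)

verticals-flipVertical : ∀ u → countSteps isVertical (map flipVertical u) ≡ countSteps isVertical u
verticals-flipVertical = countSteps-map isVertical flipVertical λ { E → refl ; W → refl ; N → refl ; S → refl }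

verticals-toHalfPlane : ∀ w → countSteps isVertical (toHalfPlane w) ≡ countSteps isVertical w
verticals-toHalfPlane = toHalfPlane-invariant _ (countSteps-++ isVertical) verticals-flipVertical

verticals-toSlitPlane : ∀ h → countSteps isVertical (toSlitPlane h) ≡ countSteps isVertical h
verticals-toSlitPlane = toSlitPlane-invariant _ (countSteps-++ isVertical) verticals-flipVertical

slitPlaneAnd : (List Step → Bool) → List Step → Bool
slitPlaneAnd K w = (onSlitPlane w ∧ endsAt point10 w) ∧ K w

halfPlaneAnd : (List Step → Bool) → List Step → Bool
halfPlaneAnd K w = halfPlane origin w ∧ K w

slit≡halfPlane : ∀ n K → (∀ w → K (toHalfPlane w) ≡ K w) → (∀ h → K (toSlitPlane h) ≡ K h) →
                 numWalks (2 * n + 1) (slitPlaneAnd K) ≡ numWalks (2 * n + 1) (halfPlaneAnd K)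
slit≡halfPlane n K K-toHalf K-toSlit = numWalks-bijection _ _ _ toHalfPlane toSlitPlane forward backward
  where
  odd : 2 * n + 1 ≡ suc (n + n)
  odd = trans (+-comm (2 * n) 1) (cong (λ k → suc (n + k)) (+-identityʳ n))
  forward : InjectionOn (2 * n + 1) (slitPlaneAnd K) (halfPlaneAnd K) toHalfPlane toSlitPlane
  forward w len t with slit , k ← Equivalence.to T-∧ t
                  with half , inverse ← toHalfPlane-inverse w (Equivalence.to (slitWalk-reflects w) slit) =
    trans (toHalfPlane-invariant length (λ u v → length-++ u) (length-map flipVertical) w) len ,
    Equivalence.from T-∧ (Equivalence.from (halfPlane-reflects _) half , subst T (sym (K-toHalf w)) k) ,
    inverse
  backward : InjectionOn (2 * n + 1) (halfPlaneAnd K) (slitPlaneAnd K) toSlitPlane toHalfPlane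
  backward h len t with half , k ← Equivalence.to T-∧ t
                   with slit , inverse ← toSlitPlane-inverse n h (trans len odd)
                                           (Equivalence.to (halfPlane-reflects h) half) =
    trans (toSlitPlane-invariant length (λ u v → length-++ u) (length-map flipVertical) h) len ,
    Equivalence.from T-∧ (Equivalence.from (slitWalk-reflects _) slit , subst T (sym (K-toSlit h)) k) ,
    inverse

slit≡shiftedHalfPlane : ∀ n K → (∀ w → K (toHalfPlane w) ≡ K w) → (∀ h → K (toSlitPlane h) ≡ K h) →
  numWalks (2 * n + 1) (slitPlaneAnd K) ≡ numWalks (2 * n) (λ w → halfPlane (1ℤ , 0ℤ) w ∧ K (E ∷ w))
slit≡shiftedHalfPlane n K K-toHalf K-toSlit = begin
  numWalks (2 * n + 1) (slitPlaneAnd K)    ≡⟨ slit≡halfPlane n K K-toHalf K-toSlit ⟩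
  numWalks (2 * n + 1) (halfPlaneAnd K)    ≡⟨ cong (λ L → numWalks L (halfPlaneAnd K)) (+-comm (2 * n) 1) ⟩
  numWalks (suc (2 * n)) (halfPlaneAnd K)  ≡⟨ halfPlane-first-step (2 * n) K ⟩
  numWalks (2 * n) (λ w → halfPlane (1ℤ , 0ℤ) w ∧ K (E ∷ w)) ∎

slitWalks≡catalan : ∀ n → numWalks (2 * n + 1) (λ w → onSlitPlane w ∧ endsAt point10 w) ≡ catalan (2 * n + 1)
slitWalks≡catalan n = begin
  numWalks (2 * n + 1) (λ w → onSlitPlane w ∧ endsAt point10 w)
    ≡⟨ numWalks-cong (2 * n + 1) (λ w → sym (∧-identityʳ _)) ⟩
  numWalks (2 * n + 1) (slitPlaneAnd λ _ → true)
    ≡⟨ slit≡shiftedHalfPlane n (λ _ → true) (λ _ → refl) (λ _ → refl) ⟩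
  numWalks (2 * n) (λ w → halfPlane (1ℤ , 0ℤ) w ∧ true)
    ≡⟨ numWalks-cong (2 * n) (λ w → ∧-identityʳ _) ⟩
  numWalks (2 * n) (halfPlane (1ℤ , 0ℤ))
    ≡⟨ numWalks-halfPlane (2 * n) 0 0ℤ ⟩
  motzkinTotal (2 * n) 0
    ≡⟨ motzkinTotal≡dyck (2 * n) 0 ⟩
  dyck (suc (2 * n + 2 * n)) 1
    ≡⟨ cong (λ l → dyck l 0) (double-odd n) ⟨
  dyck (2 * (2 * n + 1)) 0
    ≡⟨ catalan≡dyck (2 * n + 1) ⟨
  catalan (2 * n + 1)
    ∎
  where
  double-odd : ∀ n → 2 * (2 * n + 1) ≡ suc (suc (2 * n + 2 * n))
  double-odd = solve-∀

motzkin≡closed-form : ∀ n m → motzkin (2 * n) 0 (2 * m) ≡ 4 ^ m * ((2 * n) C (2 * m)) * catalan (n ∸ m)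
motzkin≡closed-form n m = begin
  motzkin (2 * n) 0 (2 * m)
    ≡⟨ motzkin≡binomial*dyck (2 * n) 0 (2 * m) ⟩
  b * 2 ^ (2 * m) * dyck (2 * n ∸ 2 * m) 0
    ≡⟨ cong₂ (λ p l → b * p * dyck l 0) (sym (^-*-assoc 2 2 m)) (sym (*-distribˡ-∸ 2 n m)) ⟩
  b * 4 ^ m * dyck (2 * (n ∸ m)) 0
    ≡⟨ cong (b * 4 ^ m *_) (catalan≡dyck (n ∸ m)) ⟨
  b * 4 ^ m * catalan (n ∸ m)
    ≡⟨ swap b (4 ^ m) (catalan (n ∸ m)) ⟩
  4 ^ m * b * catalan (n ∸ m)
    ∎
  where
  b = (2 * n) C (2 * m)
  swap : ∀ a b c → a * b * c ≡ b * a * c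
  swap = solve-∀

slitWalks-verticals : ∀ n m →
  numWalks (2 * n + 1) (λ w → onSlitPlane w ∧ endsAt point10 w ∧ ⌊ countSteps isVertical w ≟ 2 * m ⌋)
    ≡ 4 ^ m * ((2 * n) C (2 * m)) * catalan (n ∸ m)
slitWalks-verticals n m = begin
  numWalks (2 * n + 1) (λ w → onSlitPlane w ∧ endsAt point10 w ∧ K w)
    ≡⟨ numWalks-cong (2 * n + 1) (λ w → sym (∧-assoc (onSlitPlane w) (endsAt point10 w) (K w))) ⟩
  numWalks (2 * n + 1) (slitPlaneAnd K)
    ≡⟨ slit≡shiftedHalfPlane n K (K-invariant toHalfPlane verticals-toHalfPlane)
                                 (K-invariant toSlitPlane verticals-toSlitPlane) ⟩
  numWalks (2 * n) (halfPlaneVerticals (1ℤ , 0ℤ) (2 * m))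
    ≡⟨ numWalks-halfPlaneVerticals (2 * n) 0 0ℤ (2 * m) ⟩
  motzkin (2 * n) 0 (2 * m)
    ≡⟨ motzkin≡closed-form n m ⟩
  4 ^ m * ((2 * n) C (2 * m)) * catalan (n ∸ m)
    ∎
  where
  K = λ w → ⌊ countSteps isVertical w ≟ 2 * m ⌋
  K-invariant : ∀ g → (∀ w → countSteps isVertical (g w) ≡ countSteps isVertical w) → ∀ w → K (g w) ≡ K w
  K-invariant g g-invariant w = cong (λ c → ⌊ c ≟ 2 * m ⌋) (g-invariant w)

motzkinWalks-horizontals : ∀ n m →
  numWalks (2 * n) (λ w → isBicoloredMotzkin w ∧ ⌊ countSteps isHorizontal w ≟ 2 * m ⌋)
    ≡ 4 ^ m * ((2 * n) C (2 * m)) * catalan (n ∸ m)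
motzkinWalks-horizontals n m =
  trans (numWalks-motzkinHorizontals (2 * n) 0ℤ 0 (2 * m)) (motzkin≡closed-form n m)

proposition3p2 :
    (n : ℕ) →
    (numWalks (2 * n + 1) (λ w → onSlitPlane w ∧ endsAt point10 w) ≡ catalan (2 * n + 1))
    × ((m : ℕ) → m ≤ n →
        (numWalks (2 * n + 1)
           (λ w → onSlitPlane w ∧ endsAt point10 w ∧ ⌊ countSteps isVertical w ≟ 2 * m ⌋)
          ≡ 4 ^ m * ((2 * n) C (2 * m)) * catalan (n ∸ m))
        × (numWalks (2 * n)
           (λ w → isBicoloredMotzkin w ∧ ⌊ countSteps isHorizontal w ≟ 2 * m ⌋)
          ≡ 4 ^ m * ((2 * n) C (2 * m)) * catalan (n ∸ m)))
proposition3p2 n = slitWalks≡catalan n , λ m _ → slitWalks-verticals n m , motzkinWalks-horizontals n m
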